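{- Let $p$ be an odd prime, let $d\in\{0,1,\ldots,(p-1)/2\}$, and let $\lambda$ be a rational $p$-adic integer. Define $$a_p^{(d)}(\lambda):=\sum_{x=0}^{p-1}x^d\left(\frac{x(x-1)(x-\lambda)}p\right).$$ Then $$a_p^{(d)}(\lambda)\equiv (-1)^{(p+1)/2}\frac{\lambda^d}{4^d}\sum_{k=0}^{(p-1)/2}\frac{\binom{2k}k\binom{2(k+d)}{k+d}}{16^k}\lambda^k-\delta_{d,(p-1)/2}\pmod{p}.$$
   Context: $\left(\frac{\cdot}{p}\right)$ denotes the Legendre symbol (extended to rational $p$-adic integers via their residue mod $p$; it is $0$ on multiples of $p$). A rational $p$-adic integer is a rational number whose denominator is not divisible by $p$; for such numbers $a,b$, $a\equiv b\pmod{p^m}$ means $(a-b)/p^m$ is a rational $p$-adic integer. $\delta_{i,j}$ is the Kronecker delta, and $x^0=1$ for all $x$ (including $x=0$). -}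

module Defs where

open import Data.Bool using (Bool; true; false; if_then_else_)
open import Data.Nat as ℕ using (ℕ; zero; suc; NonZero)
open import Data.Nat.Divisibility using (_∣?_)
open import Data.Nat.Combinatorics using (_C_)
open import Data.Integer as ℤ using (ℤ; +_; ∣_∣)
open import Data.Rational as ℚ using (ℚ; ↥_; ↧_; ↧ₙ_; _/_)
open import Data.List using (List; []; _∷_; upTo)
open import Data.Bool.ListAction using (any)
open import Relation.Nullary using (¬_)
open import Relation.Nullary.Decidable using (⌊_⌋)
open import Data.Nat.Divisibility using (_∣_)

divℤ : ℕ → ℤ → Bool
divℤ p z = ⌊ p ∣? ∣ z ∣ ⌋

findFirst : List ℕ → (ℕ → Bool) → ℕ
findFirst [] f = 0
findFirst (x ∷ xs) f = if f x then x else findFirst xs f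

-- residue mod p of a rational p-adic integer q: the r ∈ {0,…,p-1}
-- with q ≡ r (mod p), i.e. p ∣ (numerator q - r * denominator q)
residue : ℕ → ℚ → ℕ
residue p q = findFirst (upTo p) (λ r → divℤ p (↥ q ℤ.- (+ r) ℤ.* ↧ q))

legendre : ℕ → ℕ → ℤ
legendre p a =
  if ⌊ p ∣? a ⌋ then ℤ.0ℤ
  else (if any (λ x → divℤ p ((+ (x ℕ.* x)) ℤ.- (+ a))) (upTo p)
        then ℤ.1ℤ else ℤ.-1ℤ)

legendreℚ : ℕ → ℚ → ℤ
legendreℚ p q = legendre p (residue p q)

IsPAdicInt : ℕ → ℚ → Set
IsPAdicInt p q = ¬ (p ∣ ↧ₙ q)

CongModP : (p : ℕ) → .{{NonZero p}} → ℚ → ℚ → Set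
CongModP p a b = IsPAdicInt p ((a ℚ.- b) ℚ.* ((+ 1) / p))

ℕtoℚ : ℕ → ℚ
ℕtoℚ n = (+ n) / 1

ℤtoℚ : ℤ → ℚ
ℤtoℚ z = z / 1

powℚ : ℚ → ℕ → ℚ
powℚ q zero = ℚ.1ℚ
powℚ q (suc n) = q ℚ.* powℚ q n

sumℚ : ℕ → (ℕ → ℚ) → ℚ
sumℚ zero f = ℚ.0ℚ
sumℚ (suc n) f = sumℚ n f ℚ.+ f n

apd : ℕ → ℕ → ℚ → ℚ
apd p d λ' = sumℚ p (λ x →
  ℕtoℚ (x ℕ.^ d) ℚ.* ℤtoℚ (legendreℚ p (ℕtoℚ x ℚ.* (ℕtoℚ x ℚ.- ℚ.1ℚ) ℚ.* (ℕtoℚ x ℚ.- λ'))))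

δ : ℕ → ℕ → ℚ
δ i j = if ⌊ i ℕ.≟ j ⌋ then ℚ.1ℚ else ℚ.0ℚ

rhs : ℕ → ℕ → ℚ → ℚ
rhs p d λ' =
  powℚ (ℚ.- ℚ.1ℚ) ((p ℕ.+ 1) ℕ./ 2) ℚ.* powℚ λ' d ℚ.* powℚ ((+ 1) / 4) d
  ℚ.* sumℚ (suc ((p ℕ.∸ 1) ℕ./ 2)) (λ k →
        ℕtoℚ (((2 ℕ.* k) C k) ℕ.* ((2 ℕ.* (k ℕ.+ d)) C (k ℕ.+ d)))
        ℚ.* powℚ ((+ 1) / 16) k ℚ.* powℚ λ' k)
  ℚ.- δ d ((p ℕ.∸ 1) ℕ./ 2)

-- By Euler's criterion the Legendre symbol of y is y^h modulo p, where p = 2h + 1, so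
-- a_p^(d)(λ) ≡ Σ_x x^d (x(x-1)(x-λ))^h.  Expanding both binomials turns this into a
-- combination of power sums Σ_x x^e with e ≤ 4h, and modulo p such a sum is -1 when
-- e ∈ {2h, 4h} and 0 otherwise.  The exponent 2h picks out the products
-- C(h,k) C(h,k+d), and C(h,k) ≡ (-1/4)^k C(2k,k) turns these into the coefficients of the
-- series; the exponent 4h occurs only for d = h and gives the Kronecker delta.  Rationals
-- enter only through their reductions modulo p, which respect sums and products.

module Submission where

open import Defs
open import Data.Nat using (ℕ; _≤_; _∸_; _/_; NonZero)
open import Data.Nat.Primality using (Prime)
open import Data.Rational using (ℚ)
open import Relation.Binary.PropositionalEquality using (_≢_)

open import Data.Bool using (Bool; true; false; T; if_then_else_)
open import Data.Bool.ListAction using (any)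
open import Data.Empty using (⊥-elim)
open import Data.Integer as ℤ using (ℤ; +_; _+_; _*_; -_; _-_; _^_; 0ℤ; 1ℤ; -1ℤ)
import Data.Integer.Properties as ℤ
open import Algebra.Properties.CommutativeSemigroup ℤ.+-commutativeSemigroup
  using () renaming (interchange to +-interchange)
open import Algebra.Properties.CommutativeSemigroup ℤ.*-commutativeSemigroup
  using () renaming (interchange to *-interchange)
open import Data.Integer.Divisibility.Signed
  using (_∣_; divides; ∣ᵤ⇒∣; ∣⇒∣ᵤ; ∣m⇒∣-m; ∣m∣n⇒∣m+n; ∣m⇒∣m*n; ∣n⇒∣m*n)
open import Data.Integer.DivMod using (_%ℕ_; _/ℕ_; a≡a%ℕn+[a/ℕn]*n; n%ℕd<d)
open import Data.Integer.Tactic.RingSolver using (solve-∀)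
open import Data.List using (_∷_; upTo)
open import Data.List.Membership.Propositional using (_∈_; lose)
open import Data.List.Membership.Propositional.Properties using (∈-upTo⁺)
open import Data.List.Relation.Unary.Any using (here; there; satisfied)
open import Data.List.Relation.Unary.Any.Properties using (any⁺; any⁻)
open import Data.Nat as ℕ using (zero; suc; z≤n; s≤s; _<_; _!)
open import Data.Nat.Combinatorics
  using (_C_; nCn≡1; nC1≡n; nCk≡nC[n∸k]; nCk+nC[k+1]≡[n+1]C[k+1]; k![n∸k]!∣n!; nCk≡nPk/k!)
open import Data.Nat.Combinatorics.Base using (_P_; _P′_)
open import Data.Nat.Combinatorics.Specification
  using (k>n⇒nCk≡0; nCk≡n!/k![n-k]!; nPk≡n!/[n∸k]!; nP′k≡n!/[n∸k]!; k!∣nP′k)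
open import Data.Nat.Coprimality as Coprimality using (coprime-divisor)
import Data.Nat.Divisibility as ℕ
open import Data.Nat.Divisibility using (_∣?_)
open import Data.Nat.DivMod using (m/n*n≡m; m*n/n≡m)
open import Data.Nat.Primality using (euclidsLemma; ¬prime[1]; prime⇒irreducible)
import Data.Nat.Properties as ℕ
import Data.Nat.Tactic.RingSolver as ℕ-Solver
open import Data.Product using (∃; _×_; _,_; proj₁; proj₂)
open import Data.Rational as ℚ using (mkℚ; ↥_; ↧_; ↧ₙ_; toℚᵘ)
import Data.Rational.Properties as ℚ
open import Data.Rational.Solver using (module +-*-Solver)
open import Data.Rational.Unnormalised as ℚᵘ using (mkℚᵘ; *≡*)
import Data.Rational.Unnormalised.Properties as ℚᵘ
open import Data.Sum using (_⊎_; inj₁; inj₂; [_,_]′)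
open import Data.Unit using (tt)
open import Function using (_∘′_)
open import Relation.Binary.Bundles using (Setoid)
import Relation.Binary.Reasoning.Setoid
open import Relation.Binary.Structures using (IsEquivalence)
open import Relation.Binary.PropositionalEquality
open import Relation.Nullary using (¬_; yes; no)
open import Relation.Nullary.Decidable using (⌊_⌋; toWitness; fromWitness)
open +-*-Solver using (solve; _:+_; _:*_; _:-_; _:=_; :-_)

+-≡-bounded : ∀ {a b x y} → a ≤ x → b ≤ y → a ℕ.+ b ≡ x ℕ.+ y → a ≡ x × b ≡ y
+-≡-bounded {a} {b} {x} {y} a≤x b≤y a+b≡x+y with ℕ.m≤n⇒m<n∨m≡n a≤x
... | inj₁ a<x  = ⊥-elim (ℕ.<⇒≢ (ℕ.+-mono-<-≤ a<x b≤y) a+b≡x+y)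
... | inj₂ refl = refl , ℕ.+-cancelˡ-≡ a b y a+b≡x+y

[n+n]/2≡n : ∀ n → (n ℕ.+ n) / 2 ≡ n
[n+n]/2≡n n = trans (cong (_/ 2) (trans (cong (n ℕ.+_) (sym (ℕ.+-identityʳ n))) (ℕ.*-comm 2 n))) (m*n/n≡m n 2)

C*!*!≡! : ∀ {m k} → k ≤ m → (m C k) ℕ.* (k ! ℕ.* (m ℕ.∸ k) !) ≡ m !
C*!*!≡! {m} {k} k≤m = trans (cong (ℕ._* (k ! ℕ.* (m ℕ.∸ k) !)) (nCk≡n!/k![n-k]! k≤m))
                            (m/n*n≡m {{k ℕ.!* (m ℕ.∸ k) !≢0}} (k![n∸k]!∣n! k≤m))

C*!≡P′ : ∀ {m k} → k ≤ m → (m C k) ℕ.* k ! ≡ m P′ k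
C*!≡P′ {m} {k} k≤m = trans (cong (ℕ._* k !) (trans (nCk≡nPk/k! k≤m) (cong (λ x → (x / k !) {{k ℕ.!≢0}}) P≡P′)))
                           (m/n*n≡m {{k ℕ.!≢0}} (k!∣nP′k k≤m))
  where
  P≡P′ : m Data.Nat.Combinatorics.Base.P k ≡ m P′ k
  P≡P′ = trans (nPk≡n!/[n∸k]! k≤m) (sym (nP′k≡n!/[n∸k]! k≤m))

pos-∸ : ∀ {m n} → n ≤ m → + (m ℕ.∸ n) ≡ + m - + n
pos-∸ {m} {n} n≤m = sym (trans (ℤ.m-n≡m⊖n m n) (ℤ.⊖-≥ n≤m))

pos-^ : ∀ m n → + (m ℕ.^ n) ≡ (+ m) ^ n
pos-^ m zero    = refl
pos-^ m (suc n) = trans (ℤ.pos-* m (m ℕ.^ n)) (cong (λ z → + m * z) (pos-^ m n))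

pos-C-suc : ∀ n k → + (suc n C suc k) ≡ + (n C k) + + (n C suc k)
pos-C-suc n k = trans (cong +_ (sym (nCk+nC[k+1]≡[n+1]C[k+1] n k))) (ℤ.pos-+ (n C k) (n C suc k))

^-distribʳ-* : ∀ (a b : ℤ) n → (a * b) ^ n ≡ a ^ n * b ^ n
^-distribʳ-* a b zero    = refl
^-distribʳ-* a b (suc n) = trans (cong (a * b *_) (^-distribʳ-* a b n)) (*-interchange a b (a ^ n) (b ^ n))

pos-square-^ : ∀ y j → (+ (y ℕ.* y)) ^ j ≡ (+ y) ^ (j ℕ.+ j)
pos-square-^ y j = trans (cong (_^ j) (ℤ.pos-* y y))
                         (trans (^-distribʳ-* (+ y) (+ y) j) (sym (ℤ.^-distribˡ-+-* (+ y) j j)))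

-1^[n+n]≡1 : ∀ n → -1ℤ ^ (n ℕ.+ n) ≡ 1ℤ
-1^[n+n]≡1 n = trans (ℤ.^-distribˡ-+-* -1ℤ n n) (trans (sym (^-distribʳ-* -1ℤ -1ℤ n)) (ℤ.^-zeroˡ n))

0^n≡0 : ∀ n → .{{ℕ.NonZero n}} → 0ℤ ^ n ≡ 0ℤ
0^n≡0 (suc n) = ℤ.*-zeroˡ (0ℤ ^ n)

∣⇒∣^ : ∀ {m x} k → .{{ℕ.NonZero k}} → m ∣ x → m ∣ x ^ k
∣⇒∣^ {x = x} (suc k) m∣x = ∣m⇒∣m*n (x ^ k) m∣x

-- Finite sums and the binomial theorem

∑ : ℕ → (ℕ → ℤ) → ℤ
∑ zero    f = 0ℤ
∑ (suc n) f = ∑ n f + f n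

infix 5 ∑
syntax ∑ n (λ i → e) = ∑[ i < n ] e

∑-cong : ∀ n {f g : ℕ → ℤ} → (∀ i → i < n → f i ≡ g i) → ∑ n f ≡ ∑ n g
∑-cong zero    f≡g = refl
∑-cong (suc n) f≡g = cong₂ _+_ (∑-cong n λ i i<n → f≡g i (ℕ.m<n⇒m<1+n i<n)) (f≡g n ℕ.≤-refl)

∑-zero : ∀ n → ∑[ _ < n ] 0ℤ ≡ 0ℤ
∑-zero zero    = refl
∑-zero (suc n) = cong (_+ 0ℤ) (∑-zero n)

∑-one : ∀ n → ∑[ _ < n ] 1ℤ ≡ + n
∑-one zero    = refl
∑-one (suc n) = trans (cong (_+ 1ℤ) (∑-one n)) (ℤ.+-comm (+ n) 1ℤ)

∑-distrib-+ : ∀ n (f g : ℕ → ℤ) → ∑[ i < n ] (f i + g i) ≡ ∑ n f + ∑ n g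
∑-distrib-+ zero    f g = refl
∑-distrib-+ (suc n) f g =
  trans (cong (_+ (f n + g n)) (∑-distrib-+ n f g)) (+-interchange (∑ n f) (∑ n g) (f n) (g n))

*-distribˡ-∑ : ∀ n c (f : ℕ → ℤ) → c * ∑ n f ≡ ∑[ i < n ] c * f i
*-distribˡ-∑ zero    c f = ℤ.*-zeroʳ c
*-distribˡ-∑ (suc n) c f = trans (ℤ.*-distribˡ-+ c (∑ n f) (f n)) (cong (_+ c * f n) (*-distribˡ-∑ n c f))

*-distribʳ-∑ : ∀ n c (f : ℕ → ℤ) → ∑ n f * c ≡ ∑[ i < n ] f i * c
*-distribʳ-∑ n c f = trans (ℤ.*-comm (∑ n f) c) (trans (*-distribˡ-∑ n c f) (∑-cong n λ i _ → ℤ.*-comm c (f i)))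

neg-distrib-∑ : ∀ n (f : ℕ → ℤ) → - ∑ n f ≡ ∑[ i < n ] - f i
neg-distrib-∑ zero    f = refl
neg-distrib-∑ (suc n) f = trans (ℤ.neg-distrib-+ (∑ n f) (f n)) (cong (_- f n) (neg-distrib-∑ n f))

∑-*-∑ : ∀ m n a (f g : ℕ → ℤ) → a * ∑ m f * ∑ n g ≡ ∑[ i < m ] ∑[ j < n ] a * f i * g j
∑-*-∑ m n a f g = trans (cong (_* ∑ n g) (*-distribˡ-∑ m a f))
  (trans (*-distribʳ-∑ m (∑ n g) (λ i → a * f i)) (∑-cong m λ i _ → *-distribˡ-∑ n (a * f i) g))

∑-suc : ∀ n (f : ℕ → ℤ) → ∑ (suc n) f ≡ f 0 + (∑[ i < n ] f (suc i))
∑-suc zero    f = ℤ.+-comm 0ℤ (f 0)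
∑-suc (suc n) f = trans (cong (_+ f (suc n)) (∑-suc n f)) (ℤ.+-assoc (f 0) _ _)

∑-comm : ∀ m n (f : ℕ → ℕ → ℤ) → ∑[ i < m ] ∑[ j < n ] f i j ≡ ∑[ j < n ] ∑[ i < m ] f i j
∑-comm zero    n f = sym (∑-zero n)
∑-comm (suc m) n f = trans (cong (_+ (∑[ j < n ] f m j)) (∑-comm m n f))
  (sym (∑-distrib-+ n (λ j → ∑[ i < m ] f i j) (f m)))

∑-telescope : ∀ n (g : ℕ → ℤ) → ∑[ i < n ] (g (suc i) - g i) ≡ g n - g 0
∑-telescope zero    g = sym (ℤ.+-inverseʳ (g 0))
∑-telescope (suc n) g = trans (cong (_+ (g (suc n) - g n)) (∑-telescope n g)) (lemma (g n) (g 0) (g (suc n)))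
  where
  lemma : ∀ a b c → a - b + (c - a) ≡ c - b
  lemma = solve-∀

δℤ : ℕ → ℕ → ℤ
δℤ a b = if ⌊ a ℕ.≟ b ⌋ then 1ℤ else 0ℤ

δℤ-refl : ∀ a → δℤ a a ≡ 1ℤ
δℤ-refl a with a ℕ.≟ a
... | yes _  = refl
... | no a≢a = ⊥-elim (a≢a refl)

δℤ-≢ : ∀ {a b} → a ≢ b → δℤ a b ≡ 0ℤ
δℤ-≢ {a} {b} a≢b with a ℕ.≟ b
... | yes a≡b = ⊥-elim (a≢b a≡b)
... | no _    = refl

δℤ-cong-⇔ : ∀ {a b c d} → (a ≡ b → c ≡ d) → (c ≡ d → a ≡ b) → δℤ a b ≡ δℤ c d
δℤ-cong-⇔ {a} {b} {c} {d} to from with a ℕ.≟ b | c ℕ.≟ d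
... | yes _   | yes _   = refl
... | no _    | no _    = refl
... | yes a≡b | no c≢d  = ⊥-elim (c≢d (to a≡b))
... | no a≢b  | yes c≡d = ⊥-elim (a≢b (from c≡d))

δℤ-∧ : ∀ {a b c d e f} → (a ≡ b → c ≡ d) → (a ≡ b → e ≡ f) → (c ≡ d → e ≡ f → a ≡ b) →
       δℤ a b ≡ δℤ c d * δℤ e f
δℤ-∧ {a} {b} {c} {d} {e} {f} to₁ to₂ from with a ℕ.≟ b | c ℕ.≟ d | e ℕ.≟ f
... | yes _   | yes _   | yes _   = refl
... | yes a≡b | no c≢d  | _       = ⊥-elim (c≢d (to₁ a≡b))
... | yes a≡b | yes _   | no e≢f  = ⊥-elim (e≢f (to₂ a≡b))
... | no _    | no _    | _       = refl
... | no _    | yes _   | no _    = refl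
... | no a≢b  | yes c≡d | yes e≡f = ⊥-elim (a≢b (from c≡d e≡f))

∑-δℤ : ∀ n t (f : ℕ → ℤ) → (n ≤ t → f t ≡ 0ℤ) → ∑[ j < n ] f j * δℤ j t ≡ f t
∑-δℤ zero    t f f≡0 = sym (f≡0 z≤n)
∑-δℤ (suc n) t f f≡0 with n ℕ.≟ t
... | yes refl = trans (cong₂ _+_ rest-zero (ℤ.*-identityʳ (f n))) (ℤ.+-identityˡ (f n))
  where
  rest-zero : ∑[ j < n ] f j * δℤ j n ≡ 0ℤ
  rest-zero = trans (∑-cong n λ j j<n → trans (cong (f j *_) (δℤ-≢ (ℕ.<⇒≢ j<n))) (ℤ.*-zeroʳ (f j))) (∑-zero n)
... | no n≢t = trans (cong₂ _+_ (∑-δℤ n t f λ n≤t → f≡0 (ℕ.≤∧≢⇒< n≤t n≢t))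
                                (ℤ.*-zeroʳ (f n)))
                     (ℤ.+-identityʳ (f t))

δ≡ℤtoℚ-δℤ : ∀ a b → δ a b ≡ ℤtoℚ (δℤ a b)
δ≡ℤtoℚ-δℤ a b with a ℕ.≟ b
... | yes _ = refl
... | no _  = refl

binomialTerm : ℤ → ℤ → ℕ → ℕ → ℤ
binomialTerm a b n j = + (n C j) * a ^ j * b ^ (n ℕ.∸ j)

binomialTerm-suc : ∀ a b n j →
  binomialTerm a b (suc n) (suc j) ≡ a * binomialTerm a b n j + b * binomialTerm a b n (suc j)
binomialTerm-suc a b n j with j ℕ.<? n
... | yes j<n = begin
  + (suc n C suc j) * (a * a ^ j) * b ^ (n ℕ.∸ j)
    ≡⟨ cong₂ (λ c e → c * (a * a ^ j) * b ^ e) (pos-C-suc n j) (ℕ.+-∸-assoc 1 j<n) ⟩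
  (+ (n C j) + + (n C suc j)) * (a * a ^ j) * (b * b ^ (n ℕ.∸ suc j))
    ≡⟨ lemma (+ (n C j)) (+ (n C suc j)) a (a ^ j) b (b ^ (n ℕ.∸ suc j)) ⟩
  a * (+ (n C j) * a ^ j * (b * b ^ (n ℕ.∸ suc j))) + b * binomialTerm a b n (suc j)
    ≡⟨ cong (λ e → a * (+ (n C j) * a ^ j * b ^ e) + b * binomialTerm a b n (suc j)) (ℕ.+-∸-assoc 1 j<n) ⟨
  a * binomialTerm a b n j + b * binomialTerm a b n (suc j) ∎
  where
  open ≡-Reasoning
  lemma : ∀ x y a c b d → (x + y) * (a * c) * (b * d) ≡ a * (x * c * (b * d)) + b * (y * (a * c) * d)
  lemma = solve-∀
... | no j≮n = begin
  + (suc n C suc j) * (a * a ^ j) * b ^ (n ℕ.∸ j)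
    ≡⟨ cong (λ c → c * (a * a ^ j) * b ^ (n ℕ.∸ j)) (trans (pos-C-suc n j) (cong (λ c → + (n C j) + + c) nC[1+j]≡0)) ⟩
  (+ (n C j) + 0ℤ) * (a * a ^ j) * b ^ (n ℕ.∸ j)
    ≡⟨ lemma (+ (n C j)) a (a ^ j) b (b ^ (n ℕ.∸ j)) (b ^ (n ℕ.∸ suc j)) ⟩
  a * binomialTerm a b n j + b * (+ 0 * (a * a ^ j) * b ^ (n ℕ.∸ suc j))
    ≡⟨ cong (λ c → a * binomialTerm a b n j + b * (+ c * (a * a ^ j) * b ^ (n ℕ.∸ suc j))) nC[1+j]≡0 ⟨
  a * binomialTerm a b n j + b * binomialTerm a b n (suc j) ∎
  where
  open ≡-Reasoning
  nC[1+j]≡0 : n C suc j ≡ 0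
  nC[1+j]≡0 = k>n⇒nCk≡0 (s≤s (ℕ.≮⇒≥ j≮n))
  lemma : ∀ x a c b d e → (x + 0ℤ) * (a * c) * d ≡ a * (x * c * d) + b * (0ℤ * (a * c) * e)
  lemma = solve-∀

binomial-theorem : ∀ a b n N → n < N → ∑ N (binomialTerm a b n) ≡ (a + b) ^ n
binomial-theorem a b zero (suc N) _ = trans (∑-suc N (binomialTerm a b 0)) (cong (λ s → 1ℤ + s) (∑-zero N))
binomial-theorem a b (suc n) (suc N) (s≤s n<N) = begin
  ∑ (suc N) (B (suc n))
    ≡⟨ ∑-suc N (B (suc n)) ⟩
  B (suc n) 0 + (∑[ j < N ] B (suc n) (suc j))
    ≡⟨ cong₂ _+_ (lemma₁ b (b ^ n)) (∑-cong N λ j _ → binomialTerm-suc a b n j) ⟩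
  b * B n 0 + (∑[ j < N ] (a * B n j + b * B n (suc j)))
    ≡⟨ cong (λ s → b * B n 0 + s) (∑-distrib-+ N _ _) ⟩
  b * B n 0 + ((∑[ j < N ] a * B n j) + (∑[ j < N ] b * B n (suc j)))
    ≡⟨ cong₂ (λ u v → b * B n 0 + (u + v)) (*-distribˡ-∑ N a (B n)) (*-distribˡ-∑ N b _) ⟨
  b * B n 0 + (a * ∑ N (B n) + b * (∑[ j < N ] B n (suc j)))
    ≡⟨ lemma₂ (B n 0) (∑ N (B n)) (∑[ j < N ] B n (suc j)) a b ⟩
  a * ∑ N (B n) + b * (B n 0 + (∑[ j < N ] B n (suc j)))
    ≡⟨ cong₂ (λ u v → a * u + b * v) (binomial-theorem a b n N n<N)
             (trans (sym (∑-suc N (B n))) (binomial-theorem a b n (suc N) (ℕ.m<n⇒m<1+n n<N))) ⟩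
  a * (a + b) ^ n + b * (a + b) ^ n
    ≡⟨ ℤ.*-distribʳ-+ ((a + b) ^ n) a b ⟨
  (a + b) ^ suc n ∎
  where
  open ≡-Reasoning
  B : ℕ → ℕ → ℤ
  B = binomialTerm a b
  lemma₁ : ∀ b c → 1ℤ * 1ℤ * (b * c) ≡ b * (1ℤ * 1ℤ * c)
  lemma₁ = solve-∀
  lemma₂ : ∀ t s u a b → b * t + (a * s + b * u) ≡ a * s + b * (t + u)
  lemma₂ = solve-∀

binomial-increment : ∀ a n → (a + 1ℤ) ^ suc n - a ^ suc n ≡ ∑[ j < suc n ] + (suc n C j) * a ^ j
binomial-increment a n = begin
  (a + 1ℤ) ^ suc n - a ^ suc n
    ≡⟨ cong (_- a ^ suc n) (binomial-theorem a 1ℤ (suc n) (suc (suc n)) ℕ.≤-refl) ⟨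
  ∑ (suc n) B + B (suc n) - a ^ suc n
    ≡⟨ cong (λ t → ∑ (suc n) B + t - a ^ suc n) top ⟩
  ∑ (suc n) B + a ^ suc n - a ^ suc n
    ≡⟨ lemma (∑ (suc n) B) (a ^ suc n) ⟩
  ∑ (suc n) B
    ≡⟨ ∑-cong (suc n) (λ j _ → trans (cong (+ (suc n C j) * a ^ j *_) (ℤ.^-zeroˡ (suc n ℕ.∸ j))) (ℤ.*-identityʳ _)) ⟩
  (∑[ j < suc n ] + (suc n C j) * a ^ j) ∎
  where
  open ≡-Reasoning
  B : ℕ → ℤ
  B = binomialTerm a 1ℤ (suc n)
  top : B (suc n) ≡ a ^ suc n
  top = trans (cong₂ (λ c e → + c * a ^ suc n * 1ℤ ^ e) (nCn≡1 (suc n)) (ℕ.n∸n≡0 n))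
              (trans (ℤ.*-identityʳ _) (ℤ.*-identityˡ _))
  lemma : ∀ s t → s + t - t ≡ s
  lemma = solve-∀

-- Congruences and Fermat's little theorem

module Congruence (m : ℕ) where

  infix 4 _≈_
  record _≈_ (a b : ℤ) : Set where
    constructor congruent
    field m∣a-b : + m ∣ a - b

  ≈-isEquivalence : IsEquivalence _≈_
  ≈-isEquivalence = record
    { refl  = λ {a} → congruent (divides 0ℤ (ℤ.+-inverseʳ a))
    ; sym   = λ {a} {b} (congruent m∣a-b) → congruent (subst (+ m ∣_) (lemma₁ a b) (∣m⇒∣-m m∣a-b))
    ; trans = λ {a} {b} {c} (congruent m∣a-b) (congruent m∣b-c) →
                congruent (subst (+ m ∣_) (lemma₂ a b c) (∣m∣n⇒∣m+n m∣a-b m∣b-c))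
    }
    where
    lemma₁ : ∀ a b → - (a - b) ≡ b - a
    lemma₁ = solve-∀
    lemma₂ : ∀ a b c → (a - b) + (b - c) ≡ a - c
    lemma₂ = solve-∀

  ≈-setoid : Setoid _ _
  ≈-setoid = record { isEquivalence = ≈-isEquivalence }

  open IsEquivalence ≈-isEquivalence public
    using () renaming (refl to ≈-refl; sym to ≈-sym; trans to ≈-trans; reflexive to ≡⇒≈)

  module ≈-Reasoning = Relation.Binary.Reasoning.Setoid ≈-setoid

  private variable a b c d : ℤ

  ∣⇒≈0 : + m ∣ a → a ≈ 0ℤ
  ∣⇒≈0 {a} m∣a = congruent (subst (+ m ∣_) (sym (ℤ.+-identityʳ a)) m∣a)

  ≈0⇒∣ : a ≈ 0ℤ → + m ∣ a
  ≈0⇒∣ {a} (congruent m∣a-0) = subst (+ m ∣_) (ℤ.+-identityʳ a) m∣a-0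

  m≈0 : + m ≈ 0ℤ
  m≈0 = ∣⇒≈0 (divides 1ℤ (sym (ℤ.*-identityˡ (+ m))))

  +-cong : a ≈ b → c ≈ d → a + c ≈ b + d
  +-cong {a} {b} {c} {d} (congruent m∣a-b) (congruent m∣c-d) =
    congruent (subst (+ m ∣_) (lemma a b c d) (∣m∣n⇒∣m+n m∣a-b m∣c-d))
    where
    lemma : ∀ a b c d → (a - b) + (c - d) ≡ a + c - (b + d)
    lemma = solve-∀

  -‿cong : a ≈ b → - a ≈ - b
  -‿cong {a} {b} (congruent m∣a-b) = congruent (subst (+ m ∣_) (lemma a b) (∣m⇒∣-m m∣a-b))
    where
    lemma : ∀ a b → - (a - b) ≡ - a - - b
    lemma = solve-∀

  *-cong : a ≈ b → c ≈ d → a * c ≈ b * d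
  *-cong {a} {b} {c} {d} (congruent m∣a-b) (congruent m∣c-d) =
    congruent (subst (+ m ∣_) (lemma a b c d) (∣m∣n⇒∣m+n (∣m⇒∣m*n c m∣a-b) (∣n⇒∣m*n b m∣c-d)))
    where
    lemma : ∀ a b c d → (a - b) * c + b * (c - d) ≡ a * c - b * d
    lemma = solve-∀

  *-congˡ : b ≈ c → a * b ≈ a * c
  *-congˡ {a = a} = *-cong (≈-refl {a})

  *-congʳ : b ≈ c → b * a ≈ c * a
  *-congʳ {a = a} b≈c = *-cong b≈c (≈-refl {a})

  ^-congˡ : ∀ n → a ≈ b → a ^ n ≈ b ^ n
  ^-congˡ zero    a≈b = ≈-refl
  ^-congˡ (suc n) a≈b = *-cong a≈b (^-congˡ n a≈b)

  ∑-cong-≈ : ∀ n {f g : ℕ → ℤ} → (∀ i → i < n → f i ≈ g i) → ∑ n f ≈ ∑ n g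
  ∑-cong-≈ zero    f≈g = ≈-refl
  ∑-cong-≈ (suc n) f≈g = +-cong (∑-cong-≈ n λ i i<n → f≈g i (ℕ.m<n⇒m<1+n i<n)) (f≈g n ℕ.≤-refl)

module PrimeModulus (n : ℕ) (prime : Prime (suc n)) where

  p : ℕ
  p = suc n

  open Congruence p public

  private variable a b x y : ℤ

  instance
    n≢0 : ℕ.NonZero n
    n≢0 = ℕ.>-nonZero (ℕ.≤-pred (ℕ.nonTrivial⇒n>1 p))

  p∤1 : ¬ p ℕ.∣ 1
  p∤1 p∣1 = ℕ.<⇒≢ (ℕ.nonTrivial⇒n>1 p) (sym (ℕ.∣1⇒≡1 p∣1))

  p∣*⇒p∣⊎p∣ : ∀ a b → + p ∣ a * b → + p ∣ a ⊎ + p ∣ b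
  p∣*⇒p∣⊎p∣ a b p∣ab with euclidsLemma ℤ.∣ a ∣ ℤ.∣ b ∣ prime (subst (p ℕ.∣_) (ℤ.abs-* a b) (∣⇒∣ᵤ p∣ab))
  ... | inj₁ p∣a = inj₁ (∣ᵤ⇒∣ p∣a)
  ... | inj₂ p∣b = inj₂ (∣ᵤ⇒∣ p∣b)

  p∤* : ¬ + p ∣ a → ¬ + p ∣ b → ¬ + p ∣ a * b
  p∤* {a} {b} p∤a p∤b p∣ab with p∣*⇒p∣⊎p∣ a b p∣ab
  ... | inj₁ p∣a = p∤a p∣a
  ... | inj₂ p∣b = p∤b p∣b

  *-cancelˡ-≈ : ¬ + p ∣ a → a * x ≈ a * y → x ≈ y
  *-cancelˡ-≈ {a} {x} {y} p∤a (congruent p∣ax-ay) =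
    [ ⊥-elim ∘′ p∤a , congruent ]′ (p∣*⇒p∣⊎p∣ a (x - y) (subst (+ p ∣_) (lemma a x y) p∣ax-ay))
    where
    lemma : ∀ a x y → a * x - a * y ≡ a * (x - y)
    lemma = solve-∀

  p∤-< : ∀ {k} → 0 < k → k < p → ¬ p ℕ.∣ k
  p∤-< 0<k k<p p∣k = ℕ.<⇒≱ k<p (ℕ.∣⇒≤ {{ℕ.>-nonZero 0<k}} p∣k)

  p∤! : ∀ k → k < p → ¬ p ℕ.∣ k !
  p∤! zero    _   = p∤1
  p∤! (suc k) k<p p∣k! with euclidsLemma (suc k) (k !) prime p∣k!
  ... | inj₁ p∣1+k = p∤-< (s≤s z≤n) k<p p∣1+k
  ... | inj₂ p∣k!  = p∤! k (ℕ.<⇒≤ k<p) p∣k!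

  p∣C : ∀ {m k} → k ≤ m → k < p → m ℕ.∸ k < p → p ≤ m → p ℕ.∣ m C k
  p∣C {m} {k} k≤m k<p m-k<p p≤m with euclidsLemma (m C k) _ prime p∣C*!*!
    where
    p∣C*!*! : p ℕ.∣ (m C k) ℕ.* (k ! ℕ.* (m ℕ.∸ k) !)
    p∣C*!*! = subst (p ℕ.∣_) (sym (C*!*!≡! k≤m)) (ℕ.∣-trans (ℕ.m∣m*n (n !)) (ℕ.m≤n⇒m!∣n! p≤m))
  ... | inj₁ p∣C    = p∣C
  ... | inj₂ p∣!*! with euclidsLemma (k !) _ prime p∣!*!
  ...   | inj₁ p∣k!   = ⊥-elim (p∤! k k<p p∣k!)
  ...   | inj₂ p∣m-k! = ⊥-elim (p∤! (m ℕ.∸ k) m-k<p p∣m-k!)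

  freshman's-dream : ∀ a b → (a + b) ^ p ≈ a ^ p + b ^ p
  freshman's-dream a b = begin
    (a + b) ^ p                                  ≡⟨ binomial-theorem a b p (suc p) (ℕ.n<1+n p) ⟨
    ∑ p B + B p                                  ≡⟨ cong (_+ B p) (∑-suc n B) ⟩
    B 0 + (∑[ j < n ] B (suc j)) + B p           ≈⟨ +-cong (+-cong (≈-refl {B 0}) (∑-cong-≈ n middle)) (≈-refl {B p}) ⟩
    B 0 + (∑[ j < n ] 0ℤ) + B p                  ≡⟨ cong₂ (λ s t → B 0 + s + t) (∑-zero n) Bp≡aᵖ ⟩
    B 0 + 0ℤ + a ^ p                             ≡⟨ lemma (a ^ p) (b ^ p) ⟩
    a ^ p + b ^ p                                ∎
    where
    open ≈-Reasoning
    B : ℕ → ℤ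
    B = binomialTerm a b p
    middle : ∀ j → j < n → B (suc j) ≈ 0ℤ
    middle j j<n = ∣⇒≈0 (∣m⇒∣m*n (b ^ (p ℕ.∸ suc j)) (∣m⇒∣m*n (a ^ suc j) (∣ᵤ⇒∣ {+ p} {+ (p C suc j)} p∣C[p,1+j])))
      where
      1+j<p : suc j < p
      1+j<p = s≤s j<n
      p∣C[p,1+j] : p ℕ.∣ p C suc j
      p∣C[p,1+j] = p∣C (ℕ.<⇒≤ 1+j<p) 1+j<p (ℕ.∸-monoʳ-< (s≤s z≤n) (ℕ.<⇒≤ 1+j<p)) ℕ.≤-refl
    Bp≡aᵖ : B p ≡ a ^ p
    Bp≡aᵖ = trans (cong₂ (λ c e → + c * a ^ p * b ^ e) (nCn≡1 p) (ℕ.n∸n≡0 p))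
                  (trans (ℤ.*-identityʳ _) (ℤ.*-identityˡ _))
    lemma : ∀ x y → 1ℤ * 1ℤ * y + 0ℤ + x ≡ x + y
    lemma = solve-∀

  fermat-ℕ : ∀ x → (+ x) ^ p ≈ + x
  fermat-ℕ zero    = ≡⇒≈ (ℤ.*-zeroˡ (0ℤ ^ n))
  fermat-ℕ (suc x) = begin
    (1ℤ + + x) ^ p       ≈⟨ freshman's-dream 1ℤ (+ x) ⟩
    1ℤ ^ p + (+ x) ^ p   ≈⟨ +-cong (≡⇒≈ (ℤ.^-zeroˡ p)) (fermat-ℕ x) ⟩
    1ℤ + + x             ∎
    where open ≈-Reasoning

  ≈%ℕ : ∀ a → a ≈ + (a %ℕ p)
  ≈%ℕ a = congruent (divides (a /ℕ p) (trans (cong (_- + (a %ℕ p)) (a≡a%ℕn+[a/ℕn]*n a p)) (lemma (+ (a %ℕ p)) _)))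
    where
    lemma : ∀ x y → x + y - x ≡ y
    lemma = solve-∀

  fermat : ∀ a → a ^ p ≈ a
  fermat a = begin
    a ^ p              ≈⟨ ^-congˡ p (≈%ℕ a) ⟩
    (+ (a %ℕ p)) ^ p   ≈⟨ fermat-ℕ (a %ℕ p) ⟩
    + (a %ℕ p)         ≈⟨ ≈%ℕ a ⟨
    a                  ∎
    where open ≈-Reasoning

  fermat-unit : ¬ + p ∣ a → a ^ n ≈ 1ℤ
  fermat-unit {a} p∤a = *-cancelˡ-≈ p∤a (≈-trans (fermat a) (≡⇒≈ (sym (ℤ.*-identityʳ a))))

-- Reduction of rational p-adic integers

toℚᵘ-ℤtoℚ : ∀ z → toℚᵘ (ℤtoℚ z) ℚᵘ.≃ mkℚᵘ z 0
toℚᵘ-ℤtoℚ z = ℚ.toℚᵘ-fromℚᵘ (mkℚᵘ z 0)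

ℤtoℚ-+ : ∀ a b → ℤtoℚ (a ℤ.+ b) ≡ ℤtoℚ a ℚ.+ ℤtoℚ b
ℤtoℚ-+ a b = ℚ.toℚᵘ-injective (ℚᵘ.≃-trans (toℚᵘ-ℤtoℚ (a ℤ.+ b)) (ℚᵘ.≃-sym (ℚᵘ.≃-trans (ℚ.toℚᵘ-homo-+ (ℤtoℚ a) (ℤtoℚ b))
  (ℚᵘ.≃-trans (ℚᵘ.+-cong (toℚᵘ-ℤtoℚ a) (toℚᵘ-ℤtoℚ b)) (*≡* (lemma a b))))))
  where
  lemma : ∀ a b → (a ℤ.* 1ℤ ℤ.+ b ℤ.* 1ℤ) ℤ.* 1ℤ ≡ (a ℤ.+ b) ℤ.* 1ℤ
  lemma = solve-∀

ℤtoℚ-* : ∀ a b → ℤtoℚ (a ℤ.* b) ≡ ℤtoℚ a ℚ.* ℤtoℚ b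
ℤtoℚ-* a b = ℚ.toℚᵘ-injective (ℚᵘ.≃-trans (toℚᵘ-ℤtoℚ (a ℤ.* b)) (ℚᵘ.≃-sym (ℚᵘ.≃-trans (ℚ.toℚᵘ-homo-* (ℤtoℚ a) (ℤtoℚ b))
  (ℚᵘ.≃-trans (ℚᵘ.*-cong (toℚᵘ-ℤtoℚ a) (toℚᵘ-ℤtoℚ b)) (*≡* refl)))))

ℤtoℚ-neg : ∀ a → ℤtoℚ (ℤ.- a) ≡ ℚ.- ℤtoℚ a
ℤtoℚ-neg a = ℚ.toℚᵘ-injective (ℚᵘ.≃-trans (toℚᵘ-ℤtoℚ (ℤ.- a)) (ℚᵘ.≃-sym (ℚᵘ.≃-trans (ℚ.toℚᵘ-homo‿- (ℤtoℚ a))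
  (ℚᵘ.≃-trans (ℚᵘ.-‿cong (toℚᵘ-ℤtoℚ a)) (*≡* refl)))))

ℤtoℚ-- : ∀ a b → ℤtoℚ (a ℤ.- b) ≡ ℤtoℚ a ℚ.- ℤtoℚ b
ℤtoℚ-- a b = trans (ℤtoℚ-+ a (ℤ.- b)) (cong (ℤtoℚ a ℚ.+_) (ℤtoℚ-neg b))

ℤtoℚ-injective : ∀ {a b} → ℤtoℚ a ≡ ℤtoℚ b → a ≡ b
ℤtoℚ-injective {a} {b} eq with ℚᵘ.≃-trans (ℚᵘ.≃-sym (toℚᵘ-ℤtoℚ a)) (ℚᵘ.≃-trans (ℚ.toℚᵘ-cong eq) (toℚᵘ-ℤtoℚ b))
... | *≡* a*1≡b*1 = trans (sym (ℤ.*-identityʳ a)) (trans a*1≡b*1 (ℤ.*-identityʳ b))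

ℕtoℚ-* : ∀ a b → ℕtoℚ (a ℕ.* b) ≡ ℕtoℚ a ℚ.* ℕtoℚ b
ℕtoℚ-* a b = trans (cong ℤtoℚ (ℤ.pos-* a b)) (ℤtoℚ-* (+ a) (+ b))

↧ₙ∣ : ∀ q v m → q ℚ.* ℕtoℚ v ≡ ℤtoℚ m → ↧ₙ q ℕ.∣ v
↧ₙ∣ q@(mkℚ n d-1 coprime) v m q*v≡m
  with ℚᵘ.≃-trans (ℚᵘ.≃-sym (ℚᵘ.≃-trans (ℚ.toℚᵘ-homo-* q (ℕtoℚ v)) (ℚᵘ.*-congˡ {toℚᵘ q} (toℚᵘ-ℤtoℚ (+ v)))))
                  (ℚᵘ.≃-trans (ℚ.toℚᵘ-cong q*v≡m) (toℚᵘ-ℤtoℚ m))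
... | *≡* eq = coprime-divisor (Coprimality.sym (Coprimality.recompute coprime)) (ℕ.divides ℤ.∣ m ∣ ∣n∣*v≡∣m∣*d)
  where
  ∣n∣*v≡∣m∣*d : ℤ.∣ n ∣ ℕ.* v ≡ ℤ.∣ m ∣ ℕ.* suc d-1
  ∣n∣*v≡∣m∣*d = trans (sym (trans (cong ℤ.∣_∣ (ℤ.*-identityʳ (n ℤ.* + v))) (ℤ.abs-* n (+ v))))
    (trans (cong ℤ.∣_∣ eq) (trans (ℤ.abs-* m (+ suc (d-1 ℕ.* 1))) (cong (λ z → ℤ.∣ m ∣ ℕ.* suc z) (ℕ.*-identityʳ d-1))))

*↧ₙ≡↥ : ∀ q → q ℚ.* ℕtoℚ (↧ₙ q) ≡ ℤtoℚ (↥ q)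
*↧ₙ≡↥ q@(mkℚ n d-1 _) = ℚ.toℚᵘ-injective (ℚᵘ.≃-trans (ℚ.toℚᵘ-homo-* q (ℕtoℚ (suc d-1)))
  (ℚᵘ.≃-trans (ℚᵘ.*-congˡ {toℚᵘ q} (toℚᵘ-ℤtoℚ (+ suc d-1))) (ℚᵘ.≃-trans (*≡* (lemma n d-1)) (ℚᵘ.≃-sym (toℚᵘ-ℤtoℚ n)))))
  where
  lemma : ∀ n d → n ℤ.* (+ suc d) ℤ.* (+ 1) ≡ n ℤ.* (+ suc (d ℕ.* 1))
  lemma n d rewrite ℕ.*-identityʳ d = ℤ.*-identityʳ _

1/n*n≡1 : ∀ n .{{_ : ℕ.NonZero n}} → ((+ 1) ℚ./ n) ℚ.* ℕtoℚ n ≡ ℚ.1ℚ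
1/n*n≡1 (suc n) = ℚ.toℚᵘ-injective (ℚᵘ.≃-trans (ℚ.toℚᵘ-homo-* ((+ 1) ℚ./ suc n) (ℕtoℚ (suc n)))
  (ℚᵘ.≃-trans (ℚᵘ.*-cong (ℚ.toℚᵘ-fromℚᵘ (mkℚᵘ (+ 1) n)) (toℚᵘ-ℤtoℚ (+ suc n))) (*≡* (lemma n))))
  where
  lemma : ∀ n → (+ 1) ℤ.* (+ suc n) ℤ.* (+ 1) ≡ (+ 1) ℤ.* (+ suc (n ℕ.* 1))
  lemma n rewrite ℕ.*-identityʳ n = ℤ.*-identityʳ _

findFirst-satisfies : ∀ (f : ℕ → Bool) xs → (∃ λ x → x ∈ xs × T (f x)) → T (f (findFirst xs f))
findFirst-satisfies f (x ∷ xs) (y , y∈ , fy) with f x in fx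
... | true  = subst T (sym fx) _
... | false with y∈
...   | here refl  = ⊥-elim (subst T fx fy)
...   | there y∈xs = findFirst-satisfies f xs (y , y∈xs , fy)

module Reduction (n : ℕ) (prime : Prime (suc n)) where

  open PrimeModulus n prime

  infix 4 _~_
  -- q ~ z says that q ≡ z modulo p, witnessed by q - z = p w / v with p ∤ v.
  record _~_ (q : ℚ) (z : ℤ) : Set where
    constructor reduces
    field
      v       : ℕ
      p∤v     : ¬ p ℕ.∣ v
      w       : ℤ
      [q-z]v≡pw : (q ℚ.- ℤtoℚ z) ℚ.* ℕtoℚ v ≡ ℤtoℚ (+ p ℤ.* w)

  p∤*ℕ : ∀ {a b} → ¬ p ℕ.∣ a → ¬ p ℕ.∣ b → ¬ p ℕ.∣ a ℕ.* b
  p∤*ℕ p∤a p∤b p∣ab with euclidsLemma _ _ prime p∣ab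
  ... | inj₁ p∣a = p∤a p∣a
  ... | inj₂ p∣b = p∤b p∣b

  ℤtoℚ-~ : ∀ z → ℤtoℚ z ~ z
  ℤtoℚ-~ z = reduces 1 p∤1 0ℤ
    (trans (cong (ℚ._* ℕtoℚ 1) (ℚ.+-inverseʳ (ℤtoℚ z))) (trans (ℚ.*-zeroˡ (ℕtoℚ 1)) (cong ℤtoℚ (sym (ℤ.*-zeroʳ (+ p))))))

  ~-+ : ∀ {q q′ z z′} → q ~ z → q′ ~ z′ → q ℚ.+ q′ ~ z ℤ.+ z′
  ~-+ {q} {q′} {z} {z′} (reduces v p∤v w eq) (reduces v′ p∤v′ w′ eq′) =
    reduces (v ℕ.* v′) (p∤*ℕ p∤v p∤v′) (w ℤ.* + v′ ℤ.+ w′ ℤ.* + v) (begin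
      (q ℚ.+ q′ ℚ.- ℤtoℚ (z ℤ.+ z′)) ℚ.* ℕtoℚ (v ℕ.* v′)
        ≡⟨ cong₂ (λ a b → (q ℚ.+ q′ ℚ.- a) ℚ.* b) (ℤtoℚ-+ z z′) (ℕtoℚ-* v v′) ⟩
      (q ℚ.+ q′ ℚ.- (Z ℚ.+ Z′)) ℚ.* (V ℚ.* V′)
        ≡⟨ solve 6 (λ q q′ Z Z′ V V′ → ((q :+ q′) :- (Z :+ Z′)) :* (V :* V′) := ((q :- Z) :* V) :* V′ :+ ((q′ :- Z′) :* V′) :* V) refl
             q q′ Z Z′ V V′ ⟩
      (q ℚ.- Z) ℚ.* V ℚ.* V′ ℚ.+ (q′ ℚ.- Z′) ℚ.* V′ ℚ.* V
        ≡⟨ cong₂ (λ a b → a ℚ.* V′ ℚ.+ b ℚ.* V) eq eq′ ⟩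
      ℤtoℚ (+ p ℤ.* w) ℚ.* ℤtoℚ (+ v′) ℚ.+ ℤtoℚ (+ p ℤ.* w′) ℚ.* ℤtoℚ (+ v)
        ≡⟨ trans (ℤtoℚ-+ (+ p ℤ.* w ℤ.* + v′) (+ p ℤ.* w′ ℤ.* + v))
                 (cong₂ ℚ._+_ (ℤtoℚ-* (+ p ℤ.* w) (+ v′)) (ℤtoℚ-* (+ p ℤ.* w′) (+ v))) ⟨
      ℤtoℚ (+ p ℤ.* w ℤ.* + v′ ℤ.+ + p ℤ.* w′ ℤ.* + v)
        ≡⟨ cong ℤtoℚ (lemma (+ p) w w′ (+ v) (+ v′)) ⟩
      ℤtoℚ (+ p ℤ.* (w ℤ.* + v′ ℤ.+ w′ ℤ.* + v)) ∎)
    where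
    open ≡-Reasoning
    Z : ℚ
    Z = ℤtoℚ z
    Z′ : ℚ
    Z′ = ℤtoℚ z′
    V : ℚ
    V = ℕtoℚ v
    V′ : ℚ
    V′ = ℕtoℚ v′
    lemma : ∀ P w w′ v v′ → P ℤ.* w ℤ.* v′ ℤ.+ P ℤ.* w′ ℤ.* v ≡ P ℤ.* (w ℤ.* v′ ℤ.+ w′ ℤ.* v)
    lemma = solve-∀

  ~-neg : ∀ {q z} → q ~ z → ℚ.- q ~ ℤ.- z
  ~-neg {q} {z} (reduces v p∤v w eq) = reduces v p∤v (ℤ.- w) (begin
    (ℚ.- q ℚ.- ℤtoℚ (ℤ.- z)) ℚ.* ℕtoℚ v   ≡⟨ cong (λ a → (ℚ.- q ℚ.- a) ℚ.* ℕtoℚ v) (ℤtoℚ-neg z) ⟩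
    (ℚ.- q ℚ.- ℚ.- ℤtoℚ z) ℚ.* ℕtoℚ v     ≡⟨ solve 3 (λ q Z V → ((:- q) :- (:- Z)) :* V := :- ((q :- Z) :* V)) refl q (ℤtoℚ z) (ℕtoℚ v) ⟩
    ℚ.- ((q ℚ.- ℤtoℚ z) ℚ.* ℕtoℚ v)       ≡⟨ cong ℚ.-_ eq ⟩
    ℚ.- ℤtoℚ (+ p ℤ.* w)                  ≡⟨ ℤtoℚ-neg (+ p ℤ.* w) ⟨
    ℤtoℚ (ℤ.- (+ p ℤ.* w))                ≡⟨ cong ℤtoℚ (ℤ.neg-distribʳ-* (+ p) w) ⟩
    ℤtoℚ (+ p ℤ.* ℤ.- w)                  ∎)
    where open ≡-Reasoning

  ~-- : ∀ {q q′ z z′} → q ~ z → q′ ~ z′ → q ℚ.- q′ ~ z ℤ.- z′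
  ~-- q~z q′~z′ = ~-+ q~z (~-neg q′~z′)

  ~-* : ∀ {q q′ z z′} → q ~ z → q′ ~ z′ → q ℚ.* q′ ~ z ℤ.* z′
  ~-* {q} {q′} {z} {z′} (reduces v p∤v w eq) (reduces v′ p∤v′ w′ eq′) =
    reduces (v ℕ.* v′) (p∤*ℕ p∤v p∤v′) (w ℤ.* (+ p ℤ.* w′ ℤ.+ z′ ℤ.* + v′) ℤ.+ z ℤ.* + v ℤ.* w′) (begin
      (q ℚ.* q′ ℚ.- ℤtoℚ (z ℤ.* z′)) ℚ.* ℕtoℚ (v ℕ.* v′)
        ≡⟨ cong₂ (λ a b → (q ℚ.* q′ ℚ.- a) ℚ.* b) (ℤtoℚ-* z z′) (ℕtoℚ-* v v′) ⟩
      (q ℚ.* q′ ℚ.- Z ℚ.* Z′) ℚ.* (V ℚ.* V′)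
        ≡⟨ solve 6 (λ q q′ Z Z′ V V′ → ((q :* q′) :- (Z :* Z′)) :* (V :* V′)
                     := ((q :- Z) :* V) :* (((q′ :- Z′) :* V′) :+ Z′ :* V′) :+ Z :* V :* ((q′ :- Z′) :* V′)) refl
             q q′ Z Z′ V V′ ⟩
      (q ℚ.- Z) ℚ.* V ℚ.* ((q′ ℚ.- Z′) ℚ.* V′ ℚ.+ Z′ ℚ.* V′) ℚ.+ Z ℚ.* V ℚ.* ((q′ ℚ.- Z′) ℚ.* V′)
        ≡⟨ cong₂ (λ a b → a ℚ.* (b ℚ.+ Z′ ℚ.* V′) ℚ.+ Z ℚ.* V ℚ.* b) eq eq′ ⟩
      ℤtoℚ (+ p ℤ.* w) ℚ.* (ℤtoℚ (+ p ℤ.* w′) ℚ.+ Z′ ℚ.* ℤtoℚ (+ v′)) ℚ.+ Z ℚ.* ℤtoℚ (+ v) ℚ.* ℤtoℚ (+ p ℤ.* w′)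
        ≡⟨ trans (ℤtoℚ-+ (+ p ℤ.* w ℤ.* (+ p ℤ.* w′ ℤ.+ z′ ℤ.* + v′)) (z ℤ.* + v ℤ.* (+ p ℤ.* w′))) (cong₂ ℚ._+_
             (trans (ℤtoℚ-* (+ p ℤ.* w) (+ p ℤ.* w′ ℤ.+ z′ ℤ.* + v′))
                    (cong (ℤtoℚ (+ p ℤ.* w) ℚ.*_) (trans (ℤtoℚ-+ (+ p ℤ.* w′) (z′ ℤ.* + v′)) (cong (ℤtoℚ (+ p ℤ.* w′) ℚ.+_) (ℤtoℚ-* z′ (+ v′))))))
             (trans (ℤtoℚ-* (z ℤ.* + v) (+ p ℤ.* w′)) (cong (ℚ._* ℤtoℚ (+ p ℤ.* w′)) (ℤtoℚ-* z (+ v))))) ⟨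
      ℤtoℚ (+ p ℤ.* w ℤ.* (+ p ℤ.* w′ ℤ.+ z′ ℤ.* + v′) ℤ.+ z ℤ.* + v ℤ.* (+ p ℤ.* w′))
        ≡⟨ cong ℤtoℚ (lemma (+ p) w w′ z z′ (+ v) (+ v′)) ⟩
      ℤtoℚ (+ p ℤ.* (w ℤ.* (+ p ℤ.* w′ ℤ.+ z′ ℤ.* + v′) ℤ.+ z ℤ.* + v ℤ.* w′)) ∎)
    where
    open ≡-Reasoning
    Z : ℚ
    Z = ℤtoℚ z
    Z′ : ℚ
    Z′ = ℤtoℚ z′
    V : ℚ
    V = ℕtoℚ v
    V′ : ℚ
    V′ = ℕtoℚ v′
    lemma : ∀ P w w′ z z′ v v′ → P ℤ.* w ℤ.* (P ℤ.* w′ ℤ.+ z′ ℤ.* v′) ℤ.+ z ℤ.* v ℤ.* (P ℤ.* w′)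
                                 ≡ P ℤ.* (w ℤ.* (P ℤ.* w′ ℤ.+ z′ ℤ.* v′) ℤ.+ z ℤ.* v ℤ.* w′)
    lemma = solve-∀

  ~-≈ : ∀ {q z z′} → q ~ z → z ≈ z′ → q ~ z′
  ~-≈ {q} {z} {z′} (reduces v p∤v w eq) (congruent (divides k z-z′≡kp)) = reduces v p∤v (w ℤ.+ k ℤ.* + v) (begin
    (q ℚ.- Z′) ℚ.* V                             ≡⟨ solve 4 (λ q Z Z′ V → (q :- Z′) :* V := (q :- Z) :* V :+ (Z :- Z′) :* V) refl q Z Z′ V ⟩
    (q ℚ.- Z) ℚ.* V ℚ.+ (Z ℚ.- Z′) ℚ.* V          ≡⟨ cong₂ (λ a b → a ℚ.+ b ℚ.* V) eq (sym (ℤtoℚ-- z z′)) ⟩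
    ℤtoℚ (+ p ℤ.* w) ℚ.+ ℤtoℚ (z ℤ.- z′) ℚ.* ℤtoℚ (+ v)
      ≡⟨ trans (ℤtoℚ-+ (+ p ℤ.* w) (k ℤ.* + p ℤ.* + v)) (cong (ℤtoℚ (+ p ℤ.* w) ℚ.+_)
               (trans (ℤtoℚ-* (k ℤ.* + p) (+ v)) (cong (ℚ._* ℤtoℚ (+ v)) (cong ℤtoℚ (sym z-z′≡kp))))) ⟨
    ℤtoℚ (+ p ℤ.* w ℤ.+ k ℤ.* + p ℤ.* + v)        ≡⟨ cong ℤtoℚ (lemma (+ p) w k (+ v)) ⟩
    ℤtoℚ (+ p ℤ.* (w ℤ.+ k ℤ.* + v))              ∎)
    where
    open ≡-Reasoning
    Z : ℚ
    Z = ℤtoℚ z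
    Z′ : ℚ
    Z′ = ℤtoℚ z′
    V : ℚ
    V = ℕtoℚ v
    lemma : ∀ P w k v → P ℤ.* w ℤ.+ k ℤ.* P ℤ.* v ≡ P ℤ.* (w ℤ.+ k ℤ.* v)
    lemma = solve-∀

  ~-unique : ∀ {q z z′} → q ~ z → q ~ z′ → z ≈ z′
  ~-unique {q} {z} {z′} (reduces v p∤v w eq) (reduces v′ p∤v′ w′ eq′) =
    ≈-sym (*-cancelˡ-≈ p∤vv′ (≈-trans (≡⇒≈ (ℤ.*-comm (+ (v ℕ.* v′)) z′))
          (≈-trans (congruent (subst (+ p ∣_) (lemma₀ z′ z (+ (v ℕ.* v′))) (divides (w ℤ.* + v′ ℤ.- w′ ℤ.* + v) key)))
                   (≡⇒≈ (ℤ.*-comm z (+ (v ℕ.* v′)))))))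
    where
    open ≡-Reasoning
    p∤vv′ : ¬ + p ∣ + (v ℕ.* v′)
    p∤vv′ p∣vv′ = p∤*ℕ p∤v p∤v′ (∣⇒∣ᵤ p∣vv′)
    lemma₀ : ∀ a b c → (a ℤ.- b) ℤ.* c ≡ a ℤ.* c ℤ.- b ℤ.* c
    lemma₀ = solve-∀
    key : (z′ ℤ.- z) ℤ.* + (v ℕ.* v′) ≡ (w ℤ.* + v′ ℤ.- w′ ℤ.* + v) ℤ.* + p
    key = ℤtoℚ-injective (begin
      ℤtoℚ ((z′ ℤ.- z) ℤ.* + (v ℕ.* v′))
        ≡⟨ trans (ℤtoℚ-* (z′ ℤ.- z) (+ (v ℕ.* v′))) (cong₂ ℚ._*_ (ℤtoℚ-- z′ z) (ℕtoℚ-* v v′)) ⟩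
      (ℤtoℚ z′ ℚ.- ℤtoℚ z) ℚ.* (ℕtoℚ v ℚ.* ℕtoℚ v′)
        ≡⟨ solve 5 (λ q Z Z′ V V′ → (Z′ :- Z) :* (V :* V′) := ((q :- Z) :* V) :* V′ :- ((q :- Z′) :* V′) :* V) refl
             q (ℤtoℚ z) (ℤtoℚ z′) (ℕtoℚ v) (ℕtoℚ v′) ⟩
      (q ℚ.- ℤtoℚ z) ℚ.* ℕtoℚ v ℚ.* ℕtoℚ v′ ℚ.- (q ℚ.- ℤtoℚ z′) ℚ.* ℕtoℚ v′ ℚ.* ℕtoℚ v
        ≡⟨ cong₂ (λ a b → a ℚ.* ℕtoℚ v′ ℚ.- b ℚ.* ℕtoℚ v) eq eq′ ⟩
      ℤtoℚ (+ p ℤ.* w) ℚ.* ℤtoℚ (+ v′) ℚ.- ℤtoℚ (+ p ℤ.* w′) ℚ.* ℤtoℚ (+ v)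
        ≡⟨ trans (ℤtoℚ-- (+ p ℤ.* w ℤ.* + v′) (+ p ℤ.* w′ ℤ.* + v))
                 (cong₂ ℚ._-_ (ℤtoℚ-* (+ p ℤ.* w) (+ v′)) (ℤtoℚ-* (+ p ℤ.* w′) (+ v))) ⟨
      ℤtoℚ (+ p ℤ.* w ℤ.* + v′ ℤ.- + p ℤ.* w′ ℤ.* + v)
        ≡⟨ cong ℤtoℚ (lemma (+ p) w w′ (+ v) (+ v′)) ⟩
      ℤtoℚ ((w ℤ.* + v′ ℤ.- w′ ℤ.* + v) ℤ.* + p) ∎)
      where
      lemma : ∀ P w w′ v v′ → P ℤ.* w ℤ.* v′ ℤ.- P ℤ.* w′ ℤ.* v ≡ (w ℤ.* v′ ℤ.- w′ ℤ.* v) ℤ.* P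
      lemma = solve-∀

  ~-pow : ∀ {q z} → q ~ z → ∀ k → powℚ q k ~ z ^ k
  ~-pow q~z zero    = ℤtoℚ-~ 1ℤ
  ~-pow q~z (suc k) = ~-* q~z (~-pow q~z k)

  ~-∑ : ∀ m {f : ℕ → ℚ} {g : ℕ → ℤ} → (∀ i → i < m → f i ~ g i) → sumℚ m f ~ ∑ m g
  ~-∑ zero    _   = ℤtoℚ-~ 0ℤ
  ~-∑ (suc m) f~g = ~-+ (~-∑ m λ i i<m → f~g i (ℕ.m<n⇒m<1+n i<m)) (f~g m ℕ.≤-refl)

  ~⇒p∤↧ₙ : ∀ {q z} → q ~ z → ¬ p ℕ.∣ ↧ₙ q
  ~⇒p∤↧ₙ {q} {z} (reduces v p∤v w eq) p∣↧q = p∤v (ℕ.∣-trans p∣↧q (↧ₙ∣ q v (z ℤ.* + v ℤ.+ + p ℤ.* w) q*v≡))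
    where
    q*v≡ : q ℚ.* ℕtoℚ v ≡ ℤtoℚ (z ℤ.* + v ℤ.+ + p ℤ.* w)
    q*v≡ = begin
      q ℚ.* ℕtoℚ v                                   ≡⟨ solve 3 (λ q Z V → q :* V := Z :* V :+ (q :- Z) :* V) refl q (ℤtoℚ z) (ℕtoℚ v) ⟩
      ℤtoℚ z ℚ.* ℕtoℚ v ℚ.+ (q ℚ.- ℤtoℚ z) ℚ.* ℕtoℚ v  ≡⟨ cong (ℤtoℚ z ℚ.* ℕtoℚ v ℚ.+_) eq ⟩
      ℤtoℚ z ℚ.* ℤtoℚ (+ v) ℚ.+ ℤtoℚ (+ p ℤ.* w)     ≡⟨ trans (ℤtoℚ-+ (z ℤ.* + v) (+ p ℤ.* w)) (cong (ℚ._+ ℤtoℚ (+ p ℤ.* w)) (ℤtoℚ-* z (+ v))) ⟨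
      ℤtoℚ (z ℤ.* + v ℤ.+ + p ℤ.* w)                 ∎
      where open ≡-Reasoning

  -- By Fermat, b^(p-2) is an inverse of b.
  linear-root : ∀ a b → ¬ + p ∣ b → + p ∣ a ℤ.- + ((a ℤ.* b ^ ℕ.pred n) %ℕ p) ℤ.* b
  linear-root a b p∤b = ≈0⇒∣ (begin
    a ℤ.- + ((a ℤ.* b ^ ℕ.pred n) %ℕ p) ℤ.* b  ≈⟨ +-cong (≈-refl {a}) (-‿cong (*-congʳ {a = b} (≈-sym (≈%ℕ (a ℤ.* b ^ ℕ.pred n))))) ⟩
    a ℤ.- a ℤ.* b ^ ℕ.pred n ℤ.* b            ≡⟨ cong (ℤ._-_ a) (lemma a b (ℕ.pred n)) ⟩
    a ℤ.- a ℤ.* b ^ suc (ℕ.pred n)            ≡⟨ cong (λ m → a ℤ.- a ℤ.* b ^ m) (ℕ.suc-pred n) ⟩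
    a ℤ.- a ℤ.* b ^ n                         ≈⟨ +-cong (≈-refl {a}) (-‿cong (*-congˡ {a = a} (fermat-unit p∤b))) ⟩
    a ℤ.- a ℤ.* 1ℤ                            ≡⟨ trans (cong (ℤ._-_ a) (ℤ.*-identityʳ a)) (ℤ.+-inverseʳ a) ⟩
    0ℤ                                        ∎)
    where
    open ≈-Reasoning
    lemma : ∀ a b m → a ℤ.* b ^ m ℤ.* b ≡ a ℤ.* b ^ suc m
    lemma a b m = trans (ℤ.*-assoc a (b ^ m) b) (cong (a ℤ.*_) (ℤ.*-comm (b ^ m) b))

  residue-~ : ∀ q → ¬ p ℕ.∣ ↧ₙ q → q ~ + residue p q
  residue-~ q p∤↧q = reduces (↧ₙ q) p∤↧q k (begin
    (q ℚ.- ℤtoℚ (+ r)) ℚ.* ℕtoℚ (↧ₙ q)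
      ≡⟨ solve 3 (λ q R V → (q :- R) :* V := q :* V :- R :* V) refl q (ℤtoℚ (+ r)) (ℕtoℚ (↧ₙ q)) ⟩
    q ℚ.* ℕtoℚ (↧ₙ q) ℚ.- ℤtoℚ (+ r) ℚ.* ℕtoℚ (↧ₙ q)
      ≡⟨ cong₂ ℚ._-_ (*↧ₙ≡↥ q) (sym (ℤtoℚ-* (+ r) (↧ q))) ⟩
    ℤtoℚ (↥ q) ℚ.- ℤtoℚ (+ r ℤ.* ↧ q)
      ≡⟨ ℤtoℚ-- (↥ q) (+ r ℤ.* ↧ q) ⟨
    ℤtoℚ (↥ q ℤ.- + r ℤ.* ↧ q)
      ≡⟨ cong ℤtoℚ (trans ↥q-r↧q≡kp (ℤ.*-comm k (+ p))) ⟩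
    ℤtoℚ (+ p ℤ.* k) ∎)
    where
    open ≡-Reasoning
    r : ℕ
    r = residue p q
    p∤↧q′ : ¬ + p ∣ ↧ q
    p∤↧q′ p∣↧q = p∤↧q (∣⇒∣ᵤ p∣↧q)
    r₀ : ℕ
    r₀ = (↥ q ℤ.* ↧ q ^ ℕ.pred n) %ℕ p
    r-root : + p ∣ ↥ q ℤ.- + r ℤ.* ↧ q
    r-root = ∣ᵤ⇒∣ (toWitness (findFirst-satisfies (λ r → divℤ p (↥ q ℤ.- (+ r) ℤ.* ↧ q)) (upTo p) (r₀ , ∈-upTo⁺ (n%ℕd<d (↥ q ℤ.* ↧ q ^ ℕ.pred n) p) , fromWitness (∣⇒∣ᵤ (linear-root (↥ q) (↧ q) p∤↧q′)))))
    k : ℤ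
    k = _∣_.quotient r-root
    ↥q-r↧q≡kp : ↥ q ℤ.- + r ℤ.* ↧ q ≡ k ℤ.* + p
    ↥q-r↧q≡kp = _∣_.equality r-root

-- Odd primes p = 2h + 1

module OddPrime (h : ℕ) (prime : Prime (suc (h ℕ.+ h))) where

  open PrimeModulus (h ℕ.+ h) prime public

  1≤h : 1 ≤ h
  1≤h = helper h prime
    where
    helper : ∀ h → Prime (suc (h ℕ.+ h)) → 1 ≤ h
    helper zero    prime[1] = ⊥-elim (¬prime[1] prime[1])
    helper (suc h) _        = s≤s z≤n

  instance
    h≢0 : ℕ.NonZero h
    h≢0 = ℕ.>-nonZero 1≤h

  p∤pos : ∀ {k} → 0 < k → k < p → ¬ + p ∣ + k
  p∤pos 0<k k<p p∣k = p∤-< 0<k k<p (∣⇒∣ᵤ p∣k)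

  p∤2 : ¬ p ℕ.∣ 2
  p∤2 = p∤-< (s≤s z≤n) (s≤s (ℕ.+-mono-≤ 1≤h 1≤h))

  S : ℕ → ℤ
  S e = ∑[ x < p ] (+ x) ^ e

  power-sum-recurrence : ∀ e → ∑[ j < suc e ] + (suc e C j) * S j ≡ (+ p) ^ suc e
  power-sum-recurrence e = begin
    (∑[ j < suc e ] + (suc e C j) * S j)
      ≡⟨ ∑-cong (suc e) (λ j _ → *-distribˡ-∑ p (+ (suc e C j)) (λ x → (+ x) ^ j)) ⟩
    (∑[ j < suc e ] ∑[ x < p ] + (suc e C j) * (+ x) ^ j)
      ≡⟨ ∑-comm p (suc e) (λ x j → + (suc e C j) * (+ x) ^ j) ⟨
    (∑[ x < p ] ∑[ j < suc e ] + (suc e C j) * (+ x) ^ j)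
      ≡⟨ ∑-cong p (λ x _ → trans (cong (λ a → a ^ suc e - (+ x) ^ suc e) (ℤ.+-comm 1ℤ (+ x))) (binomial-increment (+ x) e)) ⟨
    (∑[ x < p ] ((+ suc x) ^ suc e - (+ x) ^ suc e))
      ≡⟨ ∑-telescope p (λ x → (+ x) ^ suc e) ⟩
    (+ p) ^ suc e - 0ℤ ^ suc e
      ≡⟨ cong (λ z → (+ p) ^ suc e - z) (0^n≡0 (suc e)) ⟩
    (+ p) ^ suc e - 0ℤ
      ≡⟨ ℤ.+-identityʳ _ ⟩
    (+ p) ^ suc e ∎
    where open ≡-Reasoning

  [1+e]C[e]≡1+e : ∀ e → suc e C e ≡ suc e
  [1+e]C[e]≡1+e e = trans (nCk≡nC[n∸k] (ℕ.n≤1+n e)) (trans (cong (suc e C_) (ℕ.m+n∸n≡m 1 e)) (nC1≡n (suc e)))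

  power-sum≈0 : ∀ e → e < h ℕ.+ h → S e ≈ 0ℤ
  power-sum≈0 e e<2h = below (suc e) e<2h e ℕ.≤-refl
    where
    below : ∀ m → m ≤ h ℕ.+ h → ∀ e → e < m → S e ≈ 0ℤ
    below (suc m) m<2h e e<1+m with ℕ.m<1+n⇒m<n∨m≡n e<1+m
    ... | inj₁ e<m  = below m (ℕ.<⇒≤ m<2h) e e<m
    ... | inj₂ refl = *-cancelˡ-≈ (p∤pos (s≤s z≤n) (s≤s m<2h)) (begin
      + suc e * S e                                        ≡⟨ cong (λ c → + c * S e) ([1+e]C[e]≡1+e e) ⟨
      + (suc e C e) * S e                                  ≡⟨ ℤ.+-identityˡ _ ⟨
      0ℤ + + (suc e C e) * S e                             ≈⟨ +-cong lower≈0 ≈-refl ⟨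
      (∑[ j < e ] + (suc e C j) * S j) + + (suc e C e) * S e  ≡⟨ power-sum-recurrence e ⟩
      (+ p) ^ suc e                                        ≈⟨ ∣⇒≈0 (∣m⇒∣m*n ((+ p) ^ e) (divides 1ℤ (sym (ℤ.*-identityˡ (+ p))))) ⟩
      0ℤ                                                   ≡⟨ ℤ.*-zeroʳ (+ suc e) ⟨
      + suc e * 0ℤ                                         ∎)
      where
      open ≈-Reasoning
      lower≈0 : ∑[ j < e ] + (suc e C j) * S j ≈ 0ℤ
      lower≈0 = ≈-trans (∑-cong-≈ e λ j j<e → *-congˡ {a = + (suc e C j)} (below e (ℕ.<⇒≤ m<2h) j j<e))
                        (≡⇒≈ (trans (∑-cong e λ j _ → ℤ.*-zeroʳ (+ (suc e C j))) (∑-zero e)))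

  power-sum-2h : S (h ℕ.+ h) ≈ -1ℤ
  power-sum-2h = begin
    S (h ℕ.+ h)
      ≡⟨ ∑-suc (h ℕ.+ h) _ ⟩
    0ℤ ^ (h ℕ.+ h) + (∑[ x < h ℕ.+ h ] (+ suc x) ^ (h ℕ.+ h))
      ≈⟨ +-cong (≡⇒≈ (0^n≡0 (h ℕ.+ h))) (∑-cong-≈ (h ℕ.+ h) λ x x<2h → fermat-unit (p∤pos (s≤s z≤n) (s≤s x<2h))) ⟩
    0ℤ + (∑[ _ < h ℕ.+ h ] 1ℤ)
      ≡⟨ trans (ℤ.+-identityˡ _) (∑-one (h ℕ.+ h)) ⟩
    + (h ℕ.+ h)
      ≈⟨ congruent (divides 1ℤ (trans (cong +_ (ℕ.+-comm (h ℕ.+ h) 1)) (sym (ℤ.*-identityˡ (+ p))))) ⟩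
    -1ℤ ∎
    where open ≈-Reasoning

  power-sum-period : ∀ e → S (p ℕ.+ e) ≈ S (suc e)
  power-sum-period e = ∑-cong-≈ p λ x _ → begin
    (+ x) ^ (p ℕ.+ e)        ≡⟨ ℤ.^-distribˡ-+-* (+ x) p e ⟩
    (+ x) ^ p * (+ x) ^ e    ≈⟨ *-congʳ (fermat (+ x)) ⟩
    (+ x) * (+ x) ^ e        ∎
    where open ≈-Reasoning

  power-sum-≤2h : ∀ e → e ≤ h ℕ.+ h → S e ≈ - δℤ e (h ℕ.+ h)
  power-sum-≤2h e e≤2h with ℕ.m≤n⇒m<n∨m≡n e≤2h
  ... | inj₁ e<2h = ≈-trans (power-sum≈0 e e<2h) (≡⇒≈ (cong -_ (sym (δℤ-≢ (ℕ.<⇒≢ e<2h)))))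
  ... | inj₂ refl = ≈-trans power-sum-2h (≡⇒≈ (cong -_ (sym (δℤ-refl (h ℕ.+ h)))))

  power-sum : ∀ e → e ≤ (h ℕ.+ h) ℕ.+ (h ℕ.+ h) →
              S e ≈ - (δℤ e (h ℕ.+ h) + δℤ e ((h ℕ.+ h) ℕ.+ (h ℕ.+ h)))
  power-sum e e≤4h with e ℕ.≤? h ℕ.+ h
  ... | yes e≤2h = ≈-trans (power-sum-≤2h e e≤2h)
                     (≡⇒≈ (sym (trans (cong (λ δ → - (δℤ e (h ℕ.+ h) + δ)) (δℤ-≢ e≢4h))
                                      (cong -_ (ℤ.+-identityʳ _)))))
    where
    e≢4h : e ≢ (h ℕ.+ h) ℕ.+ (h ℕ.+ h)
    e≢4h = ℕ.<⇒≢ (ℕ.≤-<-trans e≤2h (ℕ.m<m+n (h ℕ.+ h) (ℕ.>-nonZero⁻¹ (h ℕ.+ h))))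
  ... | no e≰2h with ℕ.m≤n⇒∃[o]m+o≡n (ℕ.≰⇒> e≰2h)
  ...   | c , refl = ≈-trans (power-sum-period c) (≈-trans (power-sum-≤2h (suc c) 1+c≤2h)
                       (≡⇒≈ (cong -_ (trans (δℤ-cong-⇔ to from) (sym δ[p+c,2h]+δ≡δ)))))
    where
    δ[p+c,2h]+δ≡δ : δℤ (p ℕ.+ c) (h ℕ.+ h) + δℤ (p ℕ.+ c) ((h ℕ.+ h) ℕ.+ (h ℕ.+ h)) ≡ δℤ (p ℕ.+ c) ((h ℕ.+ h) ℕ.+ (h ℕ.+ h))
    δ[p+c,2h]+δ≡δ = trans (cong (_+ δℤ (p ℕ.+ c) ((h ℕ.+ h) ℕ.+ (h ℕ.+ h))) (δℤ-≢ (≢-sym (ℕ.<⇒≢ (ℕ.<-≤-trans (ℕ.n<1+n (h ℕ.+ h)) (ℕ.m≤m+n p c))))))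
                          (ℤ.+-identityˡ _)
    2h+[1+c]≡p+c : h ℕ.+ h ℕ.+ suc c ≡ p ℕ.+ c
    2h+[1+c]≡p+c = ℕ.+-suc (h ℕ.+ h) c
    to : suc c ≡ h ℕ.+ h → p ℕ.+ c ≡ (h ℕ.+ h) ℕ.+ (h ℕ.+ h)
    to 1+c≡2h = trans (sym 2h+[1+c]≡p+c) (cong (h ℕ.+ h ℕ.+_) 1+c≡2h)
    from : p ℕ.+ c ≡ (h ℕ.+ h) ℕ.+ (h ℕ.+ h) → suc c ≡ h ℕ.+ h
    from p+c≡4h = ℕ.+-cancelˡ-≡ (h ℕ.+ h) (suc c) (h ℕ.+ h) (trans 2h+[1+c]≡p+c p+c≡4h)
    1+c≤2h : suc c ≤ h ℕ.+ h
    1+c≤2h = ℕ.+-cancelˡ-≤ (h ℕ.+ h) (suc c) (h ℕ.+ h) (subst (_≤ (h ℕ.+ h) ℕ.+ (h ℕ.+ h)) (sym 2h+[1+c]≡p+c) e≤4h)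

  4^k*k!*hP′k≈-1^k*[2k]! : ∀ k → k ≤ h → (+ 4) ^ k * + (k !) * + (h P′ k) ≈ -1ℤ ^ k * + ((k ℕ.+ k) !)
  4^k*k!*hP′k≈-1^k*[2k]! zero    _     = ≈-refl
  4^k*k!*hP′k≈-1^k*[2k]! (suc k) 1+k≤h = begin
    (+ 4) ^ suc k * + (suc k !) * + (h P′ suc k)
      ≡⟨ cong₂ (λ a b → (+ 4) ^ suc k * a * b) (ℤ.pos-* (suc k) (k !))
               (trans (ℤ.pos-* (h ℕ.∸ k) (h P′ k)) (cong (_* + (h P′ k)) (pos-∸ (ℕ.<⇒≤ 1+k≤h)))) ⟩
    + 4 * (+ 4) ^ k * (+ suc k * + (k !)) * ((+ h - + k) * + (h P′ k))
      ≡⟨ lemma₁ ((+ 4) ^ k) (+ (k !)) (+ (h P′ k)) (+ h) (+ k) ⟩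
    (+ 4) ^ k * + (k !) * + (h P′ k) * (+ 4 * + suc k * (+ h - + k))
      ≈⟨ *-cong (4^k*k!*hP′k≈-1^k*[2k]! k (ℕ.<⇒≤ 1+k≤h)) (congruent (divides (+ 2 * + suc k) (lemma₂ (+ h) (+ k)))) ⟩
    -1ℤ ^ k * + ((k ℕ.+ k) !) * - (+ suc (suc (k ℕ.+ k)) * + suc (k ℕ.+ k))
      ≡⟨ lemma₃ (-1ℤ ^ k) (+ ((k ℕ.+ k) !)) (+ suc (suc (k ℕ.+ k))) (+ suc (k ℕ.+ k)) ⟩
    -1ℤ ^ suc k * (+ suc (suc (k ℕ.+ k)) * (+ suc (k ℕ.+ k) * + ((k ℕ.+ k) !)))
      ≡⟨ cong (-1ℤ ^ suc k *_) [2k+2]!≡ ⟨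
    -1ℤ ^ suc k * + ((suc k ℕ.+ suc k) !) ∎
    where
    open ≈-Reasoning
    lemma₁ : ∀ f k! P h k → + 4 * f * ((1ℤ + k) * k!) * ((h - k) * P) ≡ f * k! * P * (+ 4 * (1ℤ + k) * (h - k))
    lemma₁ = solve-∀
    lemma₂ : ∀ h k → + 4 * (1ℤ + k) * (h - k) - - ((+ 2 + (k + k)) * (1ℤ + (k + k))) ≡ + 2 * (1ℤ + k) * (1ℤ + (h + h))
    lemma₂ = solve-∀
    lemma₃ : ∀ s f a b → s * f * - (a * b) ≡ -1ℤ * s * (a * (b * f))
    lemma₃ = solve-∀
    [2k+2]!≡ : + ((suc k ℕ.+ suc k) !) ≡ + suc (suc (k ℕ.+ k)) * (+ suc (k ℕ.+ k) * + ((k ℕ.+ k) !))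
    [2k+2]!≡ = trans (cong (λ n → + (suc n !)) (ℕ.+-suc k k))
                     (trans (ℤ.pos-* (suc (suc (k ℕ.+ k))) (suc (k ℕ.+ k) !))
                            (cong (+ suc (suc (k ℕ.+ k)) *_) (ℤ.pos-* (suc (k ℕ.+ k)) ((k ℕ.+ k) !))))

  p∤k! : ∀ {k} → k < p → ¬ + p ∣ + (k !)
  p∤k! {k} k<p p∣k! = p∤! k k<p (∣⇒∣ᵤ p∣k!)

  central-binomial : ∀ k → k ≤ h → (+ 4) ^ k * + (h C k) ≈ -1ℤ ^ k * + ((k ℕ.+ k) C k)
  central-binomial k k≤h = *-cancelˡ-≈ (p∤* (p∤k! k<p) (p∤k! k<p)) (begin
    + (k !) * + (k !) * ((+ 4) ^ k * + (h C k))
      ≡⟨ lemma₁ (+ (k !)) ((+ 4) ^ k) (+ (h C k)) ⟩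
    (+ 4) ^ k * + (k !) * (+ (h C k) * + (k !))
      ≡⟨ cong ((+ 4) ^ k * + (k !) *_) (trans (sym (ℤ.pos-* (h C k) (k !))) (cong +_ (C*!≡P′ k≤h))) ⟩
    (+ 4) ^ k * + (k !) * + (h P′ k)
      ≈⟨ 4^k*k!*hP′k≈-1^k*[2k]! k k≤h ⟩
    -1ℤ ^ k * + ((k ℕ.+ k) !)
      ≡⟨ cong (λ n → -1ℤ ^ k * + n) C[2k,k]*k!*k!≡[2k]! ⟨
    -1ℤ ^ k * + (((k ℕ.+ k) C k) ℕ.* (k ! ℕ.* k !))
      ≡⟨ cong (-1ℤ ^ k *_) (trans (ℤ.pos-* ((k ℕ.+ k) C k) (k ! ℕ.* k !)) (cong (+ ((k ℕ.+ k) C k) *_) (ℤ.pos-* (k !) (k !)))) ⟩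
    -1ℤ ^ k * (+ ((k ℕ.+ k) C k) * (+ (k !) * + (k !)))
      ≡⟨ lemma₂ (-1ℤ ^ k) (+ ((k ℕ.+ k) C k)) (+ (k !)) ⟩
    + (k !) * + (k !) * (-1ℤ ^ k * + ((k ℕ.+ k) C k)) ∎)
    where
    open ≈-Reasoning
    k<p : k < p
    k<p = s≤s (ℕ.≤-trans k≤h (ℕ.m≤m+n h h))
    C[2k,k]*k!*k!≡[2k]! : ((k ℕ.+ k) C k) ℕ.* (k ! ℕ.* k !) ≡ (k ℕ.+ k) !
    C[2k,k]*k!*k!≡[2k]! = subst (λ j → ((k ℕ.+ k) C k) ℕ.* (k ! ℕ.* j !) ≡ (k ℕ.+ k) !)
                                (ℕ.m+n∸m≡n k k) (C*!*!≡! (ℕ.m≤m+n k k))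
    lemma₁ : ∀ f g c → f * f * (g * c) ≡ g * f * (c * f)
    lemma₁ = solve-∀
    lemma₂ : ∀ s c f → s * (c * (f * f)) ≡ f * f * (s * c)
    lemma₂ = solve-∀

  central-binomial-mod : ∀ m → m ≤ h ℕ.+ h → + ((m ℕ.+ m) C m) ≈ -1ℤ ^ m * ((+ 4) ^ m * + (h C m))
  central-binomial-mod m m≤2h with m ℕ.≤? h
  ... | yes m≤h = begin
    + ((m ℕ.+ m) C m)                               ≡⟨ lemma (-1ℤ ^ m) (+ ((m ℕ.+ m) C m)) (-1^[n+n]≡1′) ⟨
    -1ℤ ^ m * (-1ℤ ^ m * + ((m ℕ.+ m) C m))         ≈⟨ *-congˡ {a = -1ℤ ^ m} (central-binomial m m≤h) ⟨
    -1ℤ ^ m * ((+ 4) ^ m * + (h C m))               ∎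
    where
    open ≈-Reasoning
    -1^[n+n]≡1′ : -1ℤ ^ m * -1ℤ ^ m ≡ 1ℤ
    -1^[n+n]≡1′ = trans (sym (ℤ.^-distribˡ-+-* -1ℤ m m)) (-1^[n+n]≡1 m)
    lemma : ∀ s c → s * s ≡ 1ℤ → s * (s * c) ≡ c
    lemma s c s²≡1 = trans (sym (ℤ.*-assoc s s c)) (trans (cong (_* c) s²≡1) (ℤ.*-identityˡ c))
  ... | no m≰h = begin
    + ((m ℕ.+ m) C m)                         ≈⟨ ∣⇒≈0 (∣ᵤ⇒∣ (p∣C (ℕ.m≤m+n m m) m<p (subst (_< p) (sym (ℕ.m+n∸m≡n m m)) m<p) p≤2m)) ⟩
    0ℤ                                        ≡⟨ ℤ.*-zeroʳ (-1ℤ ^ m) ⟨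
    -1ℤ ^ m * 0ℤ                              ≡⟨ cong (-1ℤ ^ m *_) (ℤ.*-zeroʳ ((+ 4) ^ m)) ⟨
    -1ℤ ^ m * ((+ 4) ^ m * 0ℤ)                ≡⟨ cong (λ c → -1ℤ ^ m * ((+ 4) ^ m * + c)) (k>n⇒nCk≡0 h<m) ⟨
    -1ℤ ^ m * ((+ 4) ^ m * + (h C m))          ∎
    where
    open ≈-Reasoning
    h<m : h < m
    h<m = ℕ.≰⇒> m≰h
    m<p : m < p
    m<p = s≤s m≤2h
    p≤2m : p ≤ m ℕ.+ m
    p≤2m = ℕ.+-mono-≤ h<m (ℕ.<⇒≤ h<m)

  ¼ : ℤ
  ¼ = + suc h * + suc h

  -- 4 (h + 1)² = (p + 1)².
  4*¼≈1 : + 4 * ¼ ≈ 1ℤ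
  4*¼≈1 = congruent (divides (+ 3 + (+ h + + h)) (lemma (+ h)))
    where
    lemma : ∀ h → + 4 * ((1ℤ + h) * (1ℤ + h)) - 1ℤ ≡ (+ 3 + (h + h)) * (1ℤ + (h + h))
    lemma = solve-∀

  4ʰ≈1 : (+ 4) ^ h ≈ 1ℤ
  4ʰ≈1 = ≈-trans (≡⇒≈ (trans (^-distribʳ-* (+ 2) (+ 2) h) (sym (ℤ.^-distribˡ-+-* (+ 2) h h))))
                 (fermat-unit (p∤2 ∘′ ∣⇒∣ᵤ))

  ∑[y²-a]^2h≈-[aʰ+1] : ∀ a → ∑[ y < p ] (+ (y ℕ.* y) - a) ^ (h ℕ.+ h) ≈ - (a ^ h + 1ℤ)
  ∑[y²-a]^2h≈-[aʰ+1] a = begin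
    (∑[ y < p ] (+ (y ℕ.* y) - a) ^ m)
      ≡⟨ ∑-cong p (λ y _ → binomial-theorem (+ (y ℕ.* y)) (- a) m (suc m) ℕ.≤-refl) ⟨
    (∑[ y < p ] ∑[ j < suc m ] binomialTerm (+ (y ℕ.* y)) (- a) m j)
      ≡⟨ ∑-cong p (λ y _ → ∑-cong (suc m) λ j _ → term≡ y j) ⟩
    (∑[ y < p ] ∑[ j < suc m ] c j * (+ y) ^ (j ℕ.+ j))
      ≡⟨ ∑-comm p (suc m) _ ⟩
    (∑[ j < suc m ] ∑[ y < p ] c j * (+ y) ^ (j ℕ.+ j))
      ≡⟨ ∑-cong (suc m) (λ j _ → *-distribˡ-∑ p (c j) _) ⟨
    (∑[ j < suc m ] c j * S (j ℕ.+ j))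
      ≈⟨ ∑-cong-≈ (suc m) (λ j j≤m → *-congˡ {a = c j} (power-sum (j ℕ.+ j) (ℕ.+-mono-≤ (ℕ.≤-pred j≤m) (ℕ.≤-pred j≤m)))) ⟩
    (∑[ j < suc m ] c j * - (δℤ (j ℕ.+ j) m + δℤ (j ℕ.+ j) (m ℕ.+ m)))
      ≡⟨ ∑-cong (suc m) (λ j _ → cong₂ (λ u v → c j * - (u + v)) (δℤ-cong-⇔ (half-inj j h) double) (δℤ-cong-⇔ (half-inj j m) double)) ⟩
    (∑[ j < suc m ] c j * - (δℤ j h + δℤ j m))
      ≡⟨ ∑-cong (suc m) (λ j _ → lemma (c j) (δℤ j h) (δℤ j m)) ⟩
    (∑[ j < suc m ] - (c j * δℤ j h + c j * δℤ j m))
      ≡⟨ neg-distrib-∑ (suc m) _ ⟨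
    - (∑[ j < suc m ] (c j * δℤ j h + c j * δℤ j m))
      ≡⟨ cong -_ (∑-distrib-+ (suc m) _ _) ⟩
    - ((∑[ j < suc m ] c j * δℤ j h) + (∑[ j < suc m ] c j * δℤ j m))
      ≡⟨ cong₂ (λ u v → - (u + v)) (∑-δℤ (suc m) h c (λ 1+m≤h → ⊥-elim (ℕ.<⇒≱ (s≤s (ℕ.m≤m+n h h)) 1+m≤h)))
                                    (∑-δℤ (suc m) m c (λ 1+m≤m → ⊥-elim (ℕ.<⇒≱ ℕ.≤-refl 1+m≤m))) ⟩
    - (c h + c m)
      ≈⟨ -‿cong (+-cong cₕ≈aʰ (≡⇒≈ cₘ≡1)) ⟩
    - (a ^ h + 1ℤ) ∎
    where
    open ≈-Reasoning
    m : ℕ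
    m = h ℕ.+ h
    c : ℕ → ℤ
    c j = + (m C j) * (- a) ^ (m ℕ.∸ j)
    term≡ : ∀ y j → binomialTerm (+ (y ℕ.* y)) (- a) m j ≡ c j * (+ y) ^ (j ℕ.+ j)
    term≡ y j = trans (cong (λ z → + (m C j) * z * (- a) ^ (m ℕ.∸ j)) (pos-square-^ y j)) (lemma₀ (+ (m C j)) _ _)
      where
      lemma₀ : ∀ x y z → x * y * z ≡ x * z * y
      lemma₀ = solve-∀
    double : ∀ {i j} → i ≡ j → i ℕ.+ i ≡ j ℕ.+ j
    double i≡j = cong₂ ℕ._+_ i≡j i≡j
    half-inj : ∀ i j → i ℕ.+ i ≡ j ℕ.+ j → i ≡ j
    half-inj i j 2i≡2j = ℕ.*-cancelˡ-≡ i j 2 (trans (cong (i ℕ.+_) (ℕ.+-identityʳ i))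
                                                   (trans 2i≡2j (cong (j ℕ.+_) (sym (ℕ.+-identityʳ j)))))
    lemma : ∀ c u v → c * - (u + v) ≡ - (c * u + c * v)
    lemma = solve-∀
    cₘ≡1 : c m ≡ 1ℤ
    cₘ≡1 = cong₂ (λ k e → + k * (- a) ^ e) (nCn≡1 m) (ℕ.n∸n≡0 m)
    cₕ≈aʰ : c h ≈ a ^ h
    cₕ≈aʰ = begin
      + (m C h) * (- a) ^ (m ℕ.∸ h)     ≡⟨ cong (λ e → + (m C h) * (- a) ^ e) (ℕ.m+n∸m≡n h h) ⟩
      + (m C h) * (- a) ^ h             ≡⟨ cong (λ z → + (m C h) * z ^ h) (ℤ.-1*i≡-i a) ⟨
      + (m C h) * (-1ℤ * a) ^ h         ≡⟨ cong (+ (m C h) *_) (^-distribʳ-* -1ℤ a h) ⟩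
      + (m C h) * (-1ℤ ^ h * a ^ h)     ≡⟨ lemma₁ (+ (m C h)) (-1ℤ ^ h) (a ^ h) ⟩
      -1ℤ ^ h * + (m C h) * a ^ h       ≈⟨ *-congʳ (central-binomial h ℕ.≤-refl) ⟨
      (+ 4) ^ h * + (h C h) * a ^ h     ≡⟨ cong (λ k → (+ 4) ^ h * + k * a ^ h) (nCn≡1 h) ⟩
      (+ 4) ^ h * 1ℤ * a ^ h            ≈⟨ *-congʳ (≈-trans (≡⇒≈ (ℤ.*-identityʳ _)) 4ʰ≈1) ⟩
      1ℤ * a ^ h                        ≡⟨ ℤ.*-identityˡ _ ⟩
      a ^ h                             ∎
      where
      lemma₁ : ∀ x s t → x * (s * t) ≡ s * x * t
      lemma₁ = solve-∀

  -- If a is not a square modulo p then each y² - a is a unit, so by Fermat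
  -- Σ_y (y² - a)^2h ≡ p ≡ 0, which pins down a^h.
  euler-criterion : ∀ a → legendre p a ≈ (+ a) ^ h
  euler-criterion a with p ∣? a | any (λ x → divℤ p (+ (x ℕ.* x) - + a)) (upTo p) in roots
  ... | yes p∣a | _     = ≈-sym (∣⇒≈0 (∣⇒∣^ h (∣ᵤ⇒∣ p∣a)))
  ... | no p∤a  | true  = ≈-sym (square-case (satisfied (any⁻ _ (upTo p) (subst T (sym roots) tt))))
    where
    square-case : ∃ (λ x → T (divℤ p (+ (x ℕ.* x) - + a))) → (+ a) ^ h ≈ 1ℤ
    square-case (x , x²≡a) = begin
      (+ a) ^ h             ≈⟨ ^-congˡ h x²≈a ⟨
      (+ (x ℕ.* x)) ^ h     ≡⟨ pos-square-^ x h ⟩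
      (+ x) ^ (h ℕ.+ h)     ≈⟨ fermat-unit p∤x ⟩
      1ℤ                    ∎
      where
      open ≈-Reasoning
      x²≈a : + (x ℕ.* x) ≈ + a
      x²≈a = congruent (∣ᵤ⇒∣ (toWitness x²≡a))
      p∤x : ¬ + p ∣ + x
      p∤x p∣x = p∤a (∣⇒∣ᵤ (≈0⇒∣ (≈-trans (≈-sym x²≈a) (∣⇒≈0 (subst (+ p ∣_) (sym (ℤ.pos-* x x)) (∣m⇒∣m*n (+ x) p∣x))))))
  ... | no p∤a  | false = begin
    -1ℤ                                       ≡⟨ lemma ((+ a) ^ h) ⟨
    - ((+ a) ^ h + 1ℤ) + (+ a) ^ h           ≈⟨ +-cong (≈-sym (∑[y²-a]^2h≈-[aʰ+1] (+ a))) (≈-refl {(+ a) ^ h}) ⟩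
    (∑[ y < p ] (+ (y ℕ.* y) - + a) ^ (h ℕ.+ h)) + (+ a) ^ h
                                              ≈⟨ +-cong (∑-cong-≈ p λ y y<p → fermat-unit (nonRoot y y<p)) (≈-refl {(+ a) ^ h}) ⟩
    (∑[ _ < p ] 1ℤ) + (+ a) ^ h               ≡⟨ cong (_+ (+ a) ^ h) (∑-one p) ⟩
    + p + (+ a) ^ h                           ≈⟨ +-cong m≈0 (≈-refl {(+ a) ^ h}) ⟩
    0ℤ + (+ a) ^ h                            ≡⟨ ℤ.+-identityˡ _ ⟩
    (+ a) ^ h                                 ∎
    where
    open ≈-Reasoning
    nonRoot : ∀ y → y < p → ¬ + p ∣ + (y ℕ.* y) - + a
    nonRoot y y<p p∣y²-a = subst T roots (any⁺ _ (lose (∈-upTo⁺ y<p) (fromWitness (∣⇒∣ᵤ p∣y²-a))))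
    lemma : ∀ x → - (x + 1ℤ) + x ≡ -1ℤ
    lemma = solve-∀

  module CharacterSum (L : ℤ) {d : ℕ} (d≤h : d ≤ h) where

    term : ℕ → ℤ
    term x = (+ x) ^ d * ((+ x) * (+ x - 1ℤ) * (+ x - L)) ^ h

    c : ℕ → ℤ
    c i = + (h C i) * -1ℤ ^ (h ℕ.∸ i)

    c′ : ℕ → ℤ
    c′ j = + (h C j) * (- L) ^ j

    -- e i j = 2h + (i + d) - j, so the power sums keep only j = i + d (exponent 2h)
    -- and the corner i = d = h, j = 0 (exponent 4h).
    e : ℕ → ℕ → ℕ
    e i j = d ℕ.+ h ℕ.+ i ℕ.+ (h ℕ.∸ j)

    e≤4h : ∀ i j → i ≤ h → e i j ≤ (h ℕ.+ h) ℕ.+ (h ℕ.+ h)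
    e≤4h i j i≤h = ℕ.≤-trans (ℕ.+-mono-≤ (ℕ.+-mono-≤ (ℕ.+-mono-≤ d≤h (ℕ.≤-refl {h})) i≤h) (ℕ.m∸n≤m h j))
                             (ℕ.≤-reflexive (ℕ.+-assoc (h ℕ.+ h) h h))

    e+j≡2h+[i+d] : ∀ i {j} → j ≤ h → e i j ℕ.+ j ≡ (h ℕ.+ h) ℕ.+ (i ℕ.+ d)
    e+j≡2h+[i+d] i {j} j≤h = begin
      d ℕ.+ h ℕ.+ i ℕ.+ (h ℕ.∸ j) ℕ.+ j     ≡⟨ ℕ.+-assoc (d ℕ.+ h ℕ.+ i) (h ℕ.∸ j) j ⟩
      d ℕ.+ h ℕ.+ i ℕ.+ ((h ℕ.∸ j) ℕ.+ j)   ≡⟨ cong (d ℕ.+ h ℕ.+ i ℕ.+_) (ℕ.m∸n+n≡m j≤h) ⟩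
      d ℕ.+ h ℕ.+ i ℕ.+ h                   ≡⟨ lemma d h i ⟩
      (h ℕ.+ h) ℕ.+ (i ℕ.+ d)               ∎
      where
      open ≡-Reasoning
      lemma : ∀ d h i → d ℕ.+ h ℕ.+ i ℕ.+ h ≡ (h ℕ.+ h) ℕ.+ (i ℕ.+ d)
      lemma = ℕ-Solver.solve-∀

    δ[e,2h]≡δ[j,i+d] : ∀ i {j} → j ≤ h → δℤ (e i j) (h ℕ.+ h) ≡ δℤ j (i ℕ.+ d)
    δ[e,2h]≡δ[j,i+d] i {j} j≤h = δℤ-cong-⇔ to from
      where
      to : e i j ≡ h ℕ.+ h → j ≡ i ℕ.+ d
      to e≡2h = ℕ.+-cancelˡ-≡ (h ℕ.+ h) j (i ℕ.+ d) (trans (cong (ℕ._+ j) (sym e≡2h)) (e+j≡2h+[i+d] i j≤h))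
      from : j ≡ i ℕ.+ d → e i j ≡ h ℕ.+ h
      from j≡i+d = ℕ.+-cancelʳ-≡ j (e i j) (h ℕ.+ h) (trans (e+j≡2h+[i+d] i j≤h) (cong (h ℕ.+ h ℕ.+_) (sym j≡i+d)))

    e≡4h⇔j≡0∧i+d≡2h : ∀ {i j} → i ≤ h → j ≤ h →
      (e i j ≡ (h ℕ.+ h) ℕ.+ (h ℕ.+ h) → j ≡ 0 × i ℕ.+ d ≡ h ℕ.+ h) ×
      (j ≡ 0 → i ℕ.+ d ≡ h ℕ.+ h → e i j ≡ (h ℕ.+ h) ℕ.+ (h ℕ.+ h))
    e≡4h⇔j≡0∧i+d≡2h {i} {j} i≤h j≤h = to , from
      where
      to : e i j ≡ (h ℕ.+ h) ℕ.+ (h ℕ.+ h) → j ≡ 0 × i ℕ.+ d ≡ h ℕ.+ h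
      to e≡4h = j≡0 , trans (sym 2h+j≡i+d) (trans (cong (h ℕ.+ h ℕ.+_) j≡0) (ℕ.+-identityʳ (h ℕ.+ h)))
        where
        2h+j≡i+d : h ℕ.+ h ℕ.+ j ≡ i ℕ.+ d
        2h+j≡i+d = ℕ.+-cancelˡ-≡ (h ℕ.+ h) (h ℕ.+ h ℕ.+ j) (i ℕ.+ d)
          (trans (sym (ℕ.+-assoc (h ℕ.+ h) (h ℕ.+ h) j)) (trans (cong (ℕ._+ j) (sym e≡4h)) (e+j≡2h+[i+d] i j≤h)))
        j≡0 : j ≡ 0
        j≡0 = ℕ.n≤0⇒n≡0 (ℕ.+-cancelˡ-≤ (h ℕ.+ h) j 0
                (ℕ.≤-trans (ℕ.≤-reflexive 2h+j≡i+d) (ℕ.≤-trans (ℕ.+-mono-≤ i≤h d≤h) (ℕ.≤-reflexive (sym (ℕ.+-identityʳ (h ℕ.+ h)))))))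
      from : j ≡ 0 → i ℕ.+ d ≡ h ℕ.+ h → e i j ≡ (h ℕ.+ h) ℕ.+ (h ℕ.+ h)
      from refl i+d≡2h = trans (sym (ℕ.+-identityʳ (e i 0)))
                               (trans (e+j≡2h+[i+d] i z≤n) (cong (h ℕ.+ h ℕ.+_) i+d≡2h))

    δ[e,4h]≡δ[j,0]δ[i,h]δ[d,h] : ∀ {i j} → i ≤ h → j ≤ h →
      δℤ (e i j) ((h ℕ.+ h) ℕ.+ (h ℕ.+ h)) ≡ δℤ j 0 * (δℤ i h * δℤ d h)
    δ[e,4h]≡δ[j,0]δ[i,h]δ[d,h] {i} {j} i≤h j≤h =
      trans (δℤ-∧ (proj₁ ∘′ to) (proj₂ ∘′ to) from)
            (cong (δℤ j 0 *_) (δℤ-∧ (proj₁ ∘′ split) (proj₂ ∘′ split) (cong₂ ℕ._+_)))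
      where
      to : e i j ≡ (h ℕ.+ h) ℕ.+ (h ℕ.+ h) → j ≡ 0 × i ℕ.+ d ≡ h ℕ.+ h
      to = proj₁ (e≡4h⇔j≡0∧i+d≡2h i≤h j≤h)
      from : j ≡ 0 → i ℕ.+ d ≡ h ℕ.+ h → e i j ≡ (h ℕ.+ h) ℕ.+ (h ℕ.+ h)
      from = proj₂ (e≡4h⇔j≡0∧i+d≡2h i≤h j≤h)
      split : i ℕ.+ d ≡ h ℕ.+ h → i ≡ h × d ≡ h
      split = +-≡-bounded i≤h d≤h

    term-expansion : ∀ x → term x ≡ ∑[ i < suc h ] ∑[ j < suc h ] c i * c′ j * (+ x) ^ e i j
    term-expansion x = begin
      X ^ d * (X * (X - 1ℤ) * (X - L)) ^ h
        ≡⟨ cong (X ^ d *_) (trans (^-distribʳ-* (X * (X - 1ℤ)) (X - L) h) (cong (_* (X - L) ^ h) (^-distribʳ-* X (X - 1ℤ) h))) ⟩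
      X ^ d * (X ^ h * (X - 1ℤ) ^ h * (X - L) ^ h)
        ≡⟨ lemma₁ (X ^ d) (X ^ h) ((X - 1ℤ) ^ h) ((X - L) ^ h) ⟩
      X ^ d * X ^ h * (X - 1ℤ) ^ h * (X - L) ^ h
        ≡⟨ cong₂ (λ u v → X ^ d * X ^ h * u * v) (binomial-theorem X -1ℤ h (suc h) ℕ.≤-refl)
                 (trans (binomial-theorem (- L) X h (suc h) ℕ.≤-refl) (cong (_^ h) (ℤ.+-comm (- L) X))) ⟨
      X ^ d * X ^ h * ∑ (suc h) (binomialTerm X -1ℤ h) * ∑ (suc h) (binomialTerm (- L) X h)
        ≡⟨ ∑-*-∑ (suc h) (suc h) (X ^ d * X ^ h) (binomialTerm X -1ℤ h) (binomialTerm (- L) X h) ⟩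
      (∑[ i < suc h ] ∑[ j < suc h ] X ^ d * X ^ h * binomialTerm X -1ℤ h i * binomialTerm (- L) X h j)
        ≡⟨ ∑-cong (suc h) (λ i _ → ∑-cong (suc h) λ j _ →
             trans (lemma₂ (+ (h C i)) (+ (h C j)) (X ^ d) (X ^ h) (X ^ i) (-1ℤ ^ (h ℕ.∸ i)) ((- L) ^ j) (X ^ (h ℕ.∸ j)))
                   (cong (c i * c′ j *_) (sym (X^e i j)))) ⟩
      (∑[ i < suc h ] ∑[ j < suc h ] c i * c′ j * X ^ e i j) ∎
      where
      open ≡-Reasoning
      X : ℤ
      X = + x
      X^e : ∀ i j → X ^ e i j ≡ X ^ d * X ^ h * X ^ i * X ^ (h ℕ.∸ j)
      X^e i j = trans (ℤ.^-distribˡ-+-* X (d ℕ.+ h ℕ.+ i) (h ℕ.∸ j))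
        (cong (_* X ^ (h ℕ.∸ j)) (trans (ℤ.^-distribˡ-+-* X (d ℕ.+ h) i) (cong (_* X ^ i) (ℤ.^-distribˡ-+-* X d h))))
      lemma₁ : ∀ a b u v → a * (b * u * v) ≡ a * b * u * v
      lemma₁ = solve-∀
      lemma₂ : ∀ bi bj xd xh xi s l xr → xd * xh * (bi * xi * s) * (bj * l * xr) ≡ bi * s * (bj * l) * (xd * xh * xi * xr)
      lemma₂ = solve-∀

    corner-sum : (∑[ i < suc h ] - (c i * (δℤ i h * δℤ d h)) * 1ℤ) ≡ - δℤ d h
    corner-sum = begin
      (∑[ i < suc h ] - (c i * (δℤ i h * δℤ d h)) * 1ℤ)   ≡⟨ ∑-cong (suc h) (λ i _ → lemma (c i) (δℤ i h) (δℤ d h)) ⟩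
      (∑[ i < suc h ] - δℤ d h * (c i * δℤ i h))          ≡⟨ *-distribˡ-∑ (suc h) (- δℤ d h) _ ⟨
      - δℤ d h * (∑[ i < suc h ] c i * δℤ i h)            ≡⟨ cong (- δℤ d h *_) (trans (∑-δℤ (suc h) h c λ 1+h≤h → ⊥-elim (ℕ.<-irrefl refl 1+h≤h)) cₕ≡1) ⟩
      - δℤ d h * 1ℤ                                       ≡⟨ ℤ.*-identityʳ _ ⟩
      - δℤ d h                                            ∎
      where
      open ≡-Reasoning
      cₕ≡1 : c h ≡ 1ℤ
      cₕ≡1 = cong₂ (λ n k → + n * -1ℤ ^ k) (nCn≡1 h) (ℕ.n∸n≡0 h)
      lemma : ∀ c y z → - (c * (y * z)) * 1ℤ ≡ - z * (c * y)
      lemma = solve-∀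

    character-sum-expansion : ∑[ x < p ] term x ≈ (∑[ k < suc h ] - (c k * c′ (k ℕ.+ d))) - δℤ d h
    character-sum-expansion = begin
      (∑[ x < p ] term x)
        ≡⟨ ∑-cong p (λ x _ → term-expansion x) ⟩
      (∑[ x < p ] ∑[ i < suc h ] ∑[ j < suc h ] c i * c′ j * (+ x) ^ e i j)
        ≡⟨ ∑-comm p (suc h) _ ⟩
      (∑[ i < suc h ] ∑[ x < p ] ∑[ j < suc h ] c i * c′ j * (+ x) ^ e i j)
        ≡⟨ ∑-cong (suc h) (λ i _ → trans (∑-comm p (suc h) _) (∑-cong (suc h) λ j _ → sym (*-distribˡ-∑ p (c i * c′ j) _))) ⟩
      (∑[ i < suc h ] ∑[ j < suc h ] c i * c′ j * S (e i j))
        ≈⟨ ∑-cong-≈ (suc h) (λ i i≤h → ∑-cong-≈ (suc h) λ j _ → *-congˡ {a = c i * c′ j} (power-sum (e i j) (e≤4h i j (ℕ.≤-pred i≤h)))) ⟩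
      (∑[ i < suc h ] ∑[ j < suc h ] c i * c′ j * - (δℤ (e i j) (h ℕ.+ h) + δℤ (e i j) ((h ℕ.+ h) ℕ.+ (h ℕ.+ h))))
        ≡⟨ ∑-cong (suc h) (λ i i≤h → trans (∑-cong (suc h) λ j j≤h →
             trans (cong₂ (λ u v → c i * c′ j * - (u + v)) (δ[e,2h]≡δ[j,i+d] i (ℕ.≤-pred j≤h))
                                                             (δ[e,4h]≡δ[j,0]δ[i,h]δ[d,h] (ℕ.≤-pred i≤h) (ℕ.≤-pred j≤h)))
                   (lemma (c i) (c′ j) (δℤ j (i ℕ.+ d)) (δℤ j 0) (δℤ i h * δℤ d h)))
             (row i)) ⟩
      (∑[ i < suc h ] (- c i * c′ (i ℕ.+ d) + - (c i * (δℤ i h * δℤ d h)) * 1ℤ))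
        ≡⟨ ∑-distrib-+ (suc h) _ _ ⟩
      (∑[ i < suc h ] - c i * c′ (i ℕ.+ d)) + (∑[ i < suc h ] - (c i * (δℤ i h * δℤ d h)) * 1ℤ)
        ≡⟨ cong₂ _+_ (∑-cong (suc h) λ i _ → sym (ℤ.neg-distribˡ-* (c i) (c′ (i ℕ.+ d)))) corner-sum ⟩
      (∑[ k < suc h ] - (c k * c′ (k ℕ.+ d))) - δℤ d h ∎
      where
      open ≈-Reasoning
      lemma : ∀ ci cj X Z Y → ci * cj * - (X + Z * Y) ≡ - ci * (cj * X) + - (ci * Y) * (cj * Z)
      lemma = solve-∀
      row : ∀ i → (∑[ j < suc h ] (- c i * (c′ j * δℤ j (i ℕ.+ d)) + - (c i * (δℤ i h * δℤ d h)) * (c′ j * δℤ j 0)))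
                  ≡ - c i * c′ (i ℕ.+ d) + - (c i * (δℤ i h * δℤ d h)) * 1ℤ
      row i = trans (∑-distrib-+ (suc h) _ _) (cong₂ _+_
        (trans (sym (*-distribˡ-∑ (suc h) (- c i) _))
               (cong (- c i *_) (∑-δℤ (suc h) (i ℕ.+ d) c′ λ h<i+d → cong (λ n → + n * (- L) ^ (i ℕ.+ d)) (k>n⇒nCk≡0 h<i+d))))
        (trans (sym (*-distribˡ-∑ (suc h) (- (c i * (δℤ i h * δℤ d h))) _))
               (cong (- (c i * (δℤ i h * δℤ d h)) *_) (∑-δℤ (suc h) 0 c′ λ ()))))

    K : ℤ
    K = -1ℤ ^ suc h * L ^ d * ¼ ^ d

    t : ℕ → ℤ
    t k = + (((2 ℕ.* k) C k) ℕ.* ((2 ℕ.* (k ℕ.+ d)) C (k ℕ.+ d))) * (¼ * ¼) ^ k * L ^ k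

    coefficient : ∀ k → k ≤ h → - (c k * c′ (k ℕ.+ d)) ≈ K * t k
    coefficient k k≤h = ≈-sym (begin
      K * t k
        ≡⟨ cong (λ z → K * (z * (¼ * ¼) ^ k * L ^ k)) t-binomials ⟩
      K * (+ ((k ℕ.+ k) C k) * + ((k ℕ.+ d ℕ.+ (k ℕ.+ d)) C (k ℕ.+ d)) * (¼ * ¼) ^ k * L ^ k)
        ≈⟨ *-congˡ {a = K} (*-congʳ {a = L ^ k} (*-congʳ {a = (¼ * ¼) ^ k}
             (*-cong (central-binomial-mod k k≤2h) (central-binomial-mod (k ℕ.+ d) k+d≤2h)))) ⟩
      K * ((u * (F * B₁)) * (-1ℤ ^ (k ℕ.+ d) * ((+ 4) ^ (k ℕ.+ d) * B₂)) * (¼ * ¼) ^ k * L ^ k)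
        ≡⟨ cong₂ (λ a b → K * ((u * (F * B₁)) * (a * (b * B₂)) * (¼ * ¼) ^ k * L ^ k))
                 (ℤ.^-distribˡ-+-* -1ℤ k d) (ℤ.^-distribˡ-+-* (+ 4) k d) ⟩
      K * ((u * (F * B₁)) * ((u * v) * ((F * G) * B₂)) * (¼ * ¼) ^ k * L ^ k)
        ≡⟨ cong₂ (λ a b → -1ℤ * a * L ^ d * ¼ ^ d * ((u * (F * B₁)) * ((u * v) * ((F * G) * B₂)) * b * L ^ k))
                 -1ʰ≡s*u (^-distribʳ-* ¼ ¼ k) ⟩
      -1ℤ * (s * u) * L ^ d * ¼ ^ d * ((u * (F * B₁)) * ((u * v) * ((F * G) * B₂)) * (¼ ^ k * ¼ ^ k) * L ^ k)
        ≡⟨ lemma s u v F G B₁ B₂ (¼ ^ k) (¼ ^ d) (L ^ k) (L ^ d) ⟩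
      X * ((u * u) * ((¼ ^ d * G) * ((F * ¼ ^ k) * (F * ¼ ^ k))))
        ≈⟨ *-congˡ {a = X} (*-cong (≡⇒≈ u²≡1) (*-cong (¼ⁿ*4ⁿ≈1 d) (*-cong (4ⁿ*¼ⁿ≈1 k) (4ⁿ*¼ⁿ≈1 k)))) ⟩
      X * (1ℤ * (1ℤ * (1ℤ * 1ℤ)))
        ≡⟨ ℤ.*-identityʳ X ⟩
      X
        ≡⟨ lhs≡X ⟨
      - (c k * c′ (k ℕ.+ d)) ∎)
      where
      open ≈-Reasoning
      u : ℤ
      u = -1ℤ ^ k
      v : ℤ
      v = -1ℤ ^ d
      s : ℤ
      s = -1ℤ ^ (h ℕ.∸ k)
      F : ℤ
      F = (+ 4) ^ k
      G : ℤ
      G = (+ 4) ^ d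
      B₁ : ℤ
      B₁ = + (h C k)
      B₂ : ℤ
      B₂ = + (h C (k ℕ.+ d))
      X : ℤ
      X = - (s * B₁ * (B₂ * ((u * v) * (L ^ k * L ^ d))))
      k≤2h : k ≤ h ℕ.+ h
      k≤2h = ℕ.≤-trans k≤h (ℕ.m≤m+n h h)
      k+d≤2h : k ℕ.+ d ≤ h ℕ.+ h
      k+d≤2h = ℕ.+-mono-≤ k≤h d≤h
      2*n≡n+n : ∀ n → 2 ℕ.* n ≡ n ℕ.+ n
      2*n≡n+n n = cong (n ℕ.+_) (ℕ.+-identityʳ n)
      t-binomials : + (((2 ℕ.* k) C k) ℕ.* ((2 ℕ.* (k ℕ.+ d)) C (k ℕ.+ d)))
                    ≡ + ((k ℕ.+ k) C k) * + ((k ℕ.+ d ℕ.+ (k ℕ.+ d)) C (k ℕ.+ d))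
      t-binomials = trans (cong₂ (λ a b → + ((a C k) ℕ.* (b C (k ℕ.+ d)))) (2*n≡n+n k) (2*n≡n+n (k ℕ.+ d)))
                          (ℤ.pos-* ((k ℕ.+ k) C k) ((k ℕ.+ d ℕ.+ (k ℕ.+ d)) C (k ℕ.+ d)))
      -1ʰ≡s*u : -1ℤ ^ h ≡ s * u
      -1ʰ≡s*u = trans (cong (-1ℤ ^_) (sym (ℕ.m∸n+n≡m k≤h))) (ℤ.^-distribˡ-+-* -1ℤ (h ℕ.∸ k) k)
      u²≡1 : u * u ≡ 1ℤ
      u²≡1 = trans (sym (ℤ.^-distribˡ-+-* -1ℤ k k)) (-1^[n+n]≡1 k)
      4ⁿ*¼ⁿ≈1 : ∀ n → (+ 4) ^ n * ¼ ^ n ≈ 1ℤ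
      4ⁿ*¼ⁿ≈1 n = ≈-trans (≡⇒≈ (sym (^-distribʳ-* (+ 4) ¼ n))) (≈-trans (^-congˡ n 4*¼≈1) (≡⇒≈ (ℤ.^-zeroˡ n)))
      ¼ⁿ*4ⁿ≈1 : ∀ n → ¼ ^ n * (+ 4) ^ n ≈ 1ℤ
      ¼ⁿ*4ⁿ≈1 n = ≈-trans (≡⇒≈ (ℤ.*-comm (¼ ^ n) ((+ 4) ^ n))) (4ⁿ*¼ⁿ≈1 n)
      lemma : ∀ s u v F G B₁ B₂ ¼ᵏ ¼ᵈ Lᵏ Lᵈ →
        -1ℤ * (s * u) * Lᵈ * ¼ᵈ * ((u * (F * B₁)) * ((u * v) * ((F * G) * B₂)) * (¼ᵏ * ¼ᵏ) * Lᵏ)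
        ≡ (- (s * B₁ * (B₂ * ((u * v) * (Lᵏ * Lᵈ))))) * ((u * u) * ((¼ᵈ * G) * ((F * ¼ᵏ) * (F * ¼ᵏ))))
      lemma = solve-∀
      lhs≡X : - (c k * c′ (k ℕ.+ d)) ≡ X
      lhs≡X = trans (cong (λ z → - (B₁ * s * (B₂ * z))) -L^[k+d]≡)
                    (cong (λ z → - (z * (B₂ * ((u * v) * (L ^ k * L ^ d))))) (ℤ.*-comm B₁ s))
        where
        -L^[k+d]≡ : (- L) ^ (k ℕ.+ d) ≡ (u * v) * (L ^ k * L ^ d)
        -L^[k+d]≡ = trans (cong (_^ (k ℕ.+ d)) (sym (ℤ.-1*i≡-i L)))
                          (trans (^-distribʳ-* -1ℤ L (k ℕ.+ d))
                                 (cong₂ _*_ (ℤ.^-distribˡ-+-* -1ℤ k d) (ℤ.^-distribˡ-+-* L k d)))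

    character-sum : ∑[ x < p ] term x ≈ K * (∑[ k < suc h ] t k) - δℤ d h
    character-sum = ≈-trans character-sum-expansion
      (+-cong (≈-trans (∑-cong-≈ (suc h) (λ k k≤h → coefficient k (ℕ.≤-pred k≤h))) (≡⇒≈ (sym (*-distribˡ-∑ (suc h) K t))))
              (≈-refl { - δℤ d h}))

  open Reduction (h ℕ.+ h) prime

  inverse-~ : ∀ v q z → q ℚ.* ℕtoℚ v ≡ ℚ.1ℚ → ¬ p ℕ.∣ v → + v ℤ.* z ≈ 1ℤ → q ~ z
  inverse-~ v q z q*v≡1 p∤v v*z≈1 with ≈-sym v*z≈1
  ... | congruent (divides k 1-vz≡kp) = reduces v p∤v k (begin
    (q ℚ.- ℤtoℚ z) ℚ.* ℕtoℚ v                    ≡⟨ solve 3 (λ q Z V → (q :- Z) :* V := q :* V :- Z :* V) refl q (ℤtoℚ z) (ℕtoℚ v) ⟩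
    q ℚ.* ℕtoℚ v ℚ.- ℤtoℚ z ℚ.* ℕtoℚ v           ≡⟨ cong₂ ℚ._-_ q*v≡1 (sym (ℤtoℚ-* z (+ v))) ⟩
    ℤtoℚ 1ℤ ℚ.- ℤtoℚ (z ℤ.* + v)                 ≡⟨ ℤtoℚ-- 1ℤ (z ℤ.* + v) ⟨
    ℤtoℚ (1ℤ ℤ.- z ℤ.* + v)                      ≡⟨ cong ℤtoℚ (trans (cong (ℤ._-_ 1ℤ) (ℤ.*-comm z (+ v))) (trans 1-vz≡kp (ℤ.*-comm k (+ p)))) ⟩
    ℤtoℚ (+ p ℤ.* k)                             ∎)
    where open ≡-Reasoning

  [p+1]/2≡1+h : (p ℕ.+ 1) / 2 ≡ suc h
  [p+1]/2≡1+h = trans (cong (λ m → suc m / 2) (trans (ℕ.+-assoc h h 1) (cong (h ℕ.+_) (ℕ.+-comm h 1)))) ([n+n]/2≡n (suc h))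

  [p-1]/2≡h : (p ℕ.∸ 1) / 2 ≡ h
  [p-1]/2≡h = [n+n]/2≡n h

  p∤4 : ¬ p ℕ.∣ 4
  p∤4 = p∤*ℕ p∤2 p∤2

  ¼-~ : (+ 1) ℚ./ 4 ~ ¼
  ¼-~ = inverse-~ 4 ((+ 1) ℚ./ 4) ¼ (1/n*n≡1 4) p∤4 4*¼≈1

  ¼²-~ : (+ 1) ℚ./ 16 ~ ¼ ℤ.* ¼
  ¼²-~ = inverse-~ 16 ((+ 1) ℚ./ 16) (¼ ℤ.* ¼) (1/n*n≡1 16) (p∤*ℕ p∤4 p∤4)
                   (≈-trans (≡⇒≈ (lemma ¼)) (*-cong 4*¼≈1 4*¼≈1))
    where
    lemma : ∀ i → + 16 ℤ.* (i ℤ.* i) ≡ (+ 4 ℤ.* i) ℤ.* (+ 4 ℤ.* i)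
    lemma = solve-∀

  ~0⇒CongModP : ∀ {a b} → a ℚ.- b ~ 0ℤ → CongModP p a b
  ~0⇒CongModP {a} {b} (reduces v p∤v w eq) p∣↧ = p∤v (ℕ.∣-trans p∣↧ (↧ₙ∣ ((a ℚ.- b) ℚ.* 1/p) v w [a-b]/p*v≡w))
    where
    1/p : ℚ
    1/p = (+ 1) ℚ./ p
    [a-b]/p*v≡w : (a ℚ.- b) ℚ.* 1/p ℚ.* ℕtoℚ v ≡ ℤtoℚ w
    [a-b]/p*v≡w = begin
      (a ℚ.- b) ℚ.* 1/p ℚ.* ℕtoℚ v              ≡⟨ solve 3 (λ X I V → X :* I :* V := (X :* V) :* I) refl (a ℚ.- b) 1/p (ℕtoℚ v) ⟩
      (a ℚ.- b) ℚ.* ℕtoℚ v ℚ.* 1/p              ≡⟨ cong (λ x → x ℚ.* ℕtoℚ v ℚ.* 1/p) (ℚ.+-identityʳ (a ℚ.- b)) ⟨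
      (a ℚ.- b ℚ.- ℚ.0ℚ) ℚ.* ℕtoℚ v ℚ.* 1/p     ≡⟨ cong (ℚ._* 1/p) (trans eq (ℤtoℚ-* (+ p) w)) ⟩
      ℤtoℚ (+ p) ℚ.* ℤtoℚ w ℚ.* 1/p            ≡⟨ solve 3 (λ P W I → P :* W :* I := W :* (I :* P)) refl (ℤtoℚ (+ p)) (ℤtoℚ w) 1/p ⟩
      ℤtoℚ w ℚ.* (1/p ℚ.* ℕtoℚ p)              ≡⟨ cong (ℤtoℚ w ℚ.*_) (1/n*n≡1 p) ⟩
      ℤtoℚ w ℚ.* ℚ.1ℚ                          ≡⟨ ℚ.*-identityʳ (ℤtoℚ w) ⟩
      ℤtoℚ w                                   ∎
      where open ≡-Reasoning

  module _ {d : ℕ} (d≤h : d ≤ h) (λ′ : ℚ) (λ′-padic : IsPAdicInt p λ′) where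

    L : ℤ
    L = + residue p λ′

    λ′~L : λ′ ~ L
    λ′~L = residue-~ λ′ λ′-padic

    open CharacterSum L d≤h using (term; K; t; character-sum)

    summand-~ : ∀ x → ℕtoℚ (x ℕ.^ d) ℚ.* ℤtoℚ (legendreℚ p (ℕtoℚ x ℚ.* (ℕtoℚ x ℚ.- ℚ.1ℚ) ℚ.* (ℕtoℚ x ℚ.- λ′))) ~ term x
    summand-~ x = ~-* (~-≈ (ℤtoℚ-~ (+ (x ℕ.^ d))) (≡⇒≈ (pos-^ x d)))
                      (~-≈ (ℤtoℚ-~ (legendre p r)) (≈-trans (euler-criterion r) (^-congˡ h r≈Q)))
      where
      q : ℚ
      q = ℕtoℚ x ℚ.* (ℕtoℚ x ℚ.- ℚ.1ℚ) ℚ.* (ℕtoℚ x ℚ.- λ′)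
      q~Q : q ~ (+ x) ℤ.* (+ x ℤ.- 1ℤ) ℤ.* (+ x ℤ.- L)
      q~Q = ~-* (~-* (ℤtoℚ-~ (+ x)) (~-- (ℤtoℚ-~ (+ x)) (ℤtoℚ-~ 1ℤ))) (~-- (ℤtoℚ-~ (+ x)) λ′~L)
      r : ℕ
      r = residue p q
      r≈Q : + r ≈ (+ x) ℤ.* (+ x ℤ.- 1ℤ) ℤ.* (+ x ℤ.- L)
      r≈Q = ~-unique (residue-~ q (~⇒p∤↧ₙ q~Q)) q~Q

    apd-~ : apd p d λ′ ~ ∑[ x < p ] term x
    apd-~ = ~-∑ p (λ x _ → summand-~ x)

    rhsℤ : ℤ
    rhsℤ = K ℤ.* (∑[ k < suc h ] t k) ℤ.- δℤ d h

    rhs-~ : rhs p d λ′ ~ rhsℤ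
    rhs-~ = ~-- (~-* (~-* (~-* sign-~ (~-pow λ′~L d)) (~-pow ¼-~ d)) sum-~) δ-~
      where
      sign-~ : powℚ (ℚ.- ℚ.1ℚ) ((p ℕ.+ 1) / 2) ~ -1ℤ ^ suc h
      sign-~ = subst (λ a → powℚ (ℚ.- ℚ.1ℚ) a ~ -1ℤ ^ suc h) (sym [p+1]/2≡1+h) (~-pow (~-neg (ℤtoℚ-~ 1ℤ)) (suc h))
      summand : ℕ → ℚ
      summand k = ℕtoℚ (((2 ℕ.* k) C k) ℕ.* ((2 ℕ.* (k ℕ.+ d)) C (k ℕ.+ d))) ℚ.* powℚ ((+ 1) ℚ./ 16) k ℚ.* powℚ λ′ k
      sum-~ : sumℚ (suc ((p ℕ.∸ 1) / 2)) summand ~ ∑[ k < suc h ] t k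
      sum-~ = subst (λ b → sumℚ (suc b) summand ~ ∑[ k < suc h ] t k) (sym [p-1]/2≡h)
        (~-∑ (suc h) λ k _ → ~-* (~-* (ℤtoℚ-~ (+ (((2 ℕ.* k) C k) ℕ.* ((2 ℕ.* (k ℕ.+ d)) C (k ℕ.+ d))))) (~-pow ¼²-~ k)) (~-pow λ′~L k))
      δ-~ : δ d ((p ℕ.∸ 1) / 2) ~ δℤ d h
      δ-~ = subst (λ b → δ d b ~ δℤ d h) (sym [p-1]/2≡h) (subst (_~ δℤ d h) (sym (δ≡ℤtoℚ-δℤ d h)) (ℤtoℚ-~ (δℤ d h)))

    apd-rhs-~ : apd p d λ′ ℚ.- rhs p d λ′ ~ (∑[ x < p ] term x) ℤ.- rhsℤ
    apd-rhs-~ = ~-- apd-~ rhs-~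

    ∑term-rhsℤ≈0 : (∑[ x < p ] term x) ℤ.- rhsℤ ≈ 0ℤ
    ∑term-rhsℤ≈0 = ≈-trans (+-cong character-sum (≈-refl {ℤ.- rhsℤ})) (≡⇒≈ (ℤ.+-inverseʳ rhsℤ))

    apd-rhs~0 : apd p d λ′ ℚ.- rhs p d λ′ ~ 0ℤ
    apd-rhs~0 = ~-≈ apd-rhs-~ ∑term-rhsℤ≈0

    congruence : CongModP p (apd p d λ′) (rhs p d λ′)
    congruence = ~0⇒CongModP {apd p d λ′} {rhs p d λ′} apd-rhs~0

parity : ∀ n → (∃ λ h → n ≡ h ℕ.+ h) ⊎ (∃ λ h → n ≡ suc (h ℕ.+ h))
parity zero    = inj₁ (0 , refl)
parity (suc n) with parity n
... | inj₁ (h , n≡2h)   = inj₂ (h , cong suc n≡2h)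
... | inj₂ (h , n≡1+2h) = inj₁ (suc h , trans (cong suc n≡1+2h) (cong suc (sym (ℕ.+-suc h h))))

odd-prime : ∀ {p} → Prime p → p ≢ 2 → ∃ λ h → p ≡ suc (h ℕ.+ h)
odd-prime {p} prime-p p≢2 with parity p
... | inj₂ odd        = odd
... | inj₁ (h , p≡2h) with prime⇒irreducible prime-p (ℕ.divides h (trans p≡2h (trans (cong (h ℕ.+_) (sym (ℕ.+-identityʳ h))) (ℕ.*-comm 2 h))))
...   | inj₁ ()
...   | inj₂ 2≡p = ⊥-elim (p≢2 (sym 2≡p))

odd-case : ∀ p .{{_ : NonZero p}} h → p ≡ suc (h ℕ.+ h) → Prime p →
           ∀ d → d ≤ (p ∸ 1) / 2 → ∀ λ' → IsPAdicInt p λ' → CongModP p (apd p d λ') (rhs p d λ')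
odd-case _ h refl prime-p d d≤[p-1]/2 λ' λ'-padic =
  OddPrime.congruence h prime-p (subst (d ≤_) ([n+n]/2≡n h) d≤[p-1]/2) λ' λ'-padic

theorem1p1 : (p : ℕ) → .{{_ : NonZero p}} → Prime p → p ≢ 2 →
    (d : ℕ) → d ≤ (p ∸ 1) / 2 →
    (λ' : ℚ) → IsPAdicInt p λ' →
    CongModP p (apd p d λ') (rhs p d λ')
theorem1p1 p prime-p p≢2 d d≤[p-1]/2 λ' λ'-padic =
  odd-case p (proj₁ p-odd) (proj₂ p-odd) prime-p d d≤[p-1]/2 λ' λ'-padic
  where
  p-odd : ∃ λ h → p ≡ suc (h ℕ.+ h)
  p-odd = odd-prime prime-p p≢2
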